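{- Let $n\ge 3$ and $2\le s\le n-1$. Then the number $N(n,s)$ of $n$-variable $s$-symmetric nested canalizing functions is $$N(n,s)=2\sum_{\lceil s/2\rceil\le r\le s}\ \sum_{\substack{k_1+\cdots+k_r=n\\ k_i\ge 1,\ k_r\ge 2}}\frac{n!}{k_1!k_2!\cdots k_r!}\sum_{\substack{t_1+\cdots+t_r=s\\ 1\le t_i\le\min\{2,k_i\}}}\ \prod_{i=1}^{r}\Big((t_i-1)(2^{k_i}-2)+1-(-1)^{t_i}\Big).$$
   Context: $\oplus$ is addition modulo 2. A Boolean function $f:\mathbb{F}_2^n\to\mathbb{F}_2$ is nested canalizing (NCF) if for some permutation $\sigma$ of $\{1,\dots,n\}$ and $a_i,b_i\in\mathbb{F}_2$: $f=b_1$ if $x_{\sigma(1)}=a_1$; $f=b_k$ if $x_{\sigma(i)}=a_i\oplus1$ for $i<k$ and $x_{\sigma(k)}=a_k$ ($k\le n$); and $f=b_n\oplus 1$ if $x_{\sigma(i)}=a_i\oplus 1$ for all $i$. For $i,j\in\{1,\dots,n\}$ write $i\sim_f j$ if $f$ is unchanged when $x_i$ and $x_j$ are swapped; this is an equivalence relation, and $f$ is $s$-symmetric if $\{1,\dots,n\}$ has exactly $s$ equivalence classes under $\sim_f$. Functions are counted as distinct functions $\mathbb{F}_2^n\to\mathbb{F}_2$; the inner sums run over integer tuples $(k_1,\dots,k_r)$ and $(t_1,\dots,t_r)$ satisfying the indicated constraints. -}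

module Defs where

open import Data.Bool using (Bool; true; false; not; _∧_)
open import Data.Bool.Properties using (T?)
open import Data.Nat as ℕ using (ℕ; zero; suc; _≤_; _<ᵇ_; _≡ᵇ_; _≤ᵇ_; ⌈_/2⌉; NonZero; _!)
open import Data.Nat.Properties using (_!≢0; m*n≢0)
open import Data.Integer as ℤ using (ℤ; +_; _-_)
open import Data.Fin as Fin using (Fin; fromℕ)
open import Data.Fin.Permutation using (Permutation′; _⟨$⟩ʳ_)
import Data.Fin.Permutation.Components as PC
open import Data.Vec as Vec using (Vec; []; _∷_)
open import Data.List as List using (List; []; _∷_; upTo; filter; length; map; concatMap)
open import Data.List.Relation.Unary.All using (All)
open import Data.List.Relation.Unary.Any using (Any)
open import Data.List.Relation.Unary.AllPairs using (AllPairs)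
open import Data.Product using (Σ; ∃; _×_)
open import Data.Empty using (⊥)
open import Relation.Nullary using (¬_)
open import Relation.Binary.PropositionalEquality using (_≡_)

-- Boolean functions F₂ⁿ → F₂ (F₂ = Bool, ⊕ 1 = not)

BoolFun : ℕ → Set
BoolFun n = (Fin n → Bool) → Bool

_≐_ : ∀ {n} → BoolFun n → BoolFun n → Set
f ≐ g = ∀ x → f x ≡ g x

IsNCF : ∀ {n} → BoolFun n → Set
IsNCF {zero}  f = ⊥
IsNCF {suc m} f =
  Σ (Permutation′ (suc m)) λ σ →
  Σ (Fin (suc m) → Bool) λ a →
  Σ (Fin (suc m) → Bool) λ b →
    (∀ x → (k : Fin (suc m)) →
       (∀ (i : Fin (suc m)) → i Fin.< k → x (σ ⟨$⟩ʳ i) ≡ not (a i)) →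
       x (σ ⟨$⟩ʳ k) ≡ a k → f x ≡ b k)
  × (∀ x → (∀ (i : Fin (suc m)) → x (σ ⟨$⟩ʳ i) ≡ not (a i)) →
       f x ≡ not (b (fromℕ m)))

_∼⟨_⟩_ : ∀ {n} → Fin n → BoolFun n → Fin n → Set
i ∼⟨ f ⟩ j = ∀ x → f (λ k → x (PC.transpose i j k)) ≡ f x

-- f is s-symmetric: {1..n} has exactly s classes under ∼_f, i.e. there is a
-- system of s representatives, pairwise inequivalent, covering every index.
IsSSymmetric : ∀ {n} → ℕ → BoolFun n → Set
IsSSymmetric {n} s f =
  Σ (Fin s → Fin n) λ rep →
    (∀ p q → ¬ (p ≡ q) → ¬ (rep p ∼⟨ f ⟩ rep q))
  × (∀ i → ∃ λ p → i ∼⟨ f ⟩ rep p)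

-- the set of f satisfying P (up to ≐) has exactly N elements:
-- a duplicate-free list of such functions representing all of them.
HasCardinality : ∀ {n} → (BoolFun n → Set) → ℕ → Set
HasCardinality {n} P N =
  Σ (List (BoolFun n)) λ L →
    (length L ≡ N)
  × All P L
  × AllPairs (λ f g → ¬ (f ≐ g)) L
  × (∀ f → P f → Any (λ g → f ≐ g) L)

tuples : (r bound : ℕ) → List (Vec ℕ r)
tuples zero    bound = [] ∷ []
tuples (suc r) bound =
  concatMap (λ v → map (λ x → x ∷ v) (upTo (suc bound))) (tuples r bound)

vsum : ∀ {r} → Vec ℕ r → ℕ
vsum = Vec.foldr _ ℕ._+_ 0

allB : ∀ {r} → (ℕ → Bool) → Vec ℕ r → Bool
allB p []       = true
allB p (x ∷ xs) = p x ∧ allB p xs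

lastB : ∀ {r} → (ℕ → Bool) → Vec ℕ r → Bool
lastB p []           = true
lastB p (x ∷ [])     = p x
lastB p (x ∷ y ∷ ys) = lastB p (y ∷ ys)

allB₂ : ∀ {r} → (ℕ → ℕ → Bool) → Vec ℕ r → Vec ℕ r → Bool
allB₂ p []       []       = true
allB₂ p (x ∷ xs) (y ∷ ys) = p x y ∧ allB₂ p xs ys

ks : (r n : ℕ) → List (Vec ℕ r)
ks r n = filter (λ k → T? ((vsum k ≡ᵇ n) ∧ allB (1 ≤ᵇ_) k ∧ lastB (2 ≤ᵇ_) k))
                (tuples r n)

ts : ∀ {r} → (s : ℕ) → Vec ℕ r → List (Vec ℕ r)
ts {r} s k = filter (λ t → T? ((vsum t ≡ᵇ s) ∧ allB (1 ≤ᵇ_) t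
                                ∧ allB₂ (λ tᵢ kᵢ → tᵢ ≤ᵇ ℕ._⊓_ 2 kᵢ) t k))
                    (tuples r s)

factProd : ∀ {r} → Vec ℕ r → ℕ
factProd []       = 1
factProd (x ∷ xs) = (x !) ℕ.* factProd xs

factProd≢0 : ∀ {r} (v : Vec ℕ r) → NonZero (factProd v)
factProd≢0 []       = _
factProd≢0 (x ∷ xs) = m*n≢0 (x !) (factProd xs) {{x !≢0}} {{factProd≢0 xs}}

multinomial : ∀ {r} → ℕ → Vec ℕ r → ℕ
multinomial n k = ℕ._/_ (n !) (factProd k) {{factProd≢0 k}}

neg1^ : ℕ → ℤ
neg1^ zero    = + 1
neg1^ (suc t) = ℤ.- neg1^ t

factor : ℕ → ℕ → ℤ
factor t k = (+ t - + 1) ℤ.* (+ (2 ℕ.^ k) - + 2) ℤ.+ + 1 - neg1^ t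

vprodZ : ∀ {r} → Vec ℕ r → Vec ℕ r → ℤ
vprodZ []       []       = + 1
vprodZ (t ∷ ts) (k ∷ ks) = factor t k ℤ.* vprodZ ts ks

sumZ : List ℤ → ℤ
sumZ = List.foldr ℤ._+_ (+ 0)

rs : ℕ → List ℕ
rs s = filter (λ r → ⌈ s /2⌉ ℕ.≤? r) (upTo (suc s))

Nformula : ℕ → ℕ → ℤ
Nformula n s =
  + 2 ℤ.* sumZ (map (λ r →
      sumZ (map (λ k →
        + multinomial n k ℤ.* sumZ (map (λ t → vprodZ t k) (ts s k)))
        (ks r n)))
      (rs s))

∃Card : ∀ {n} → (BoolFun n → Set) → (ℕ → Set) → Set
∃Card P Q = Σ ℕ λ N → Q N × HasCardinality P N

-- Grouping the canalising variables of a nested canalising function into maximal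
-- runs with the same output writes it uniquely as a layered function: layers
-- L₁, …, L_r partitioning the variables, outputs alternating between layers, and
-- |L_r| ≥ 2.  Two variables are symmetric exactly when they lie in the same layer
-- with the same canalising value, so the symmetry classes are the pairs (layer,
-- value) that occur and s = t₁ + ⋯ + t_r with t_i ∈ {1, 2} the number of values
-- used in L_i.  Hence N(n,s) is twice (for the first output) the number of such
-- layerings with s classes: the layer sizes k_i give the multinomial coefficient,
-- and a layer of size k_i carries 2 labellings with one value and 2^{k_i} − 2 with
-- two, which is the factor (t_i − 1)(2^{k_i} − 2) + 1 − (−1)^{t_i}.
module Submission where

open import Data.Bool using (Bool; true; false; not; _∧_; _∨_; if_then_else_; T)
open import Data.Bool.Properties using (T?; T-∧; T-≡; not-involutive; not-¬; ¬-not; ∨-zeroʳ; ∧-identityʳ)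
open import Data.Empty using (⊥; ⊥-elim)
open import Data.Fin as Fin using (Fin; zero; suc; _≟_; fromℕ)
open import Data.Fin.Permutation using (Permutation′; _⟨$⟩ʳ_; _⟨$⟩ˡ_; inverseˡ; inverseʳ; permutation)
open import Data.Fin.Permutation.Components using (transpose; transpose-inverse)
open import Data.Fin.Properties
  using (suc-injective; 0≢1+n; cantor-schröder-bernstein; cast-is-id; cast-involutive)
import Data.Integer as ℤ
import Data.Integer.Properties as ℤP
open import Data.List as List using (List; []; _∷_; _++_; length; upTo)
open import Data.List.Membership.Propositional using (_∈_; find; lose)
open import Data.List.Membership.Propositional.Properties
  using (∈-++⁺ˡ; ∈-++⁺ʳ; ∈-++⁻; ∈-map⁺; ∈-map⁻; ∈-lookup; ∈-tabulate⁺; ∈-concatMap⁺; ∈-concatMap⁻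
  ; ∈-filter⁺; ∈-filter⁻; ∈-upTo⁺)
open import Data.List.Properties using (length-++; length-map; ++-identityʳ; ++-conicalˡ; tabulate-lookup)
import Data.List.Properties as List
open import Data.List.Relation.Unary.All as All using (All; []; _∷_)
import Data.List.Relation.Unary.All.Properties as Allₚ
open import Data.List.Relation.Unary.AllPairs as AllPairs using (AllPairs; []; _∷_)
import Data.List.Relation.Unary.AllPairs.Properties as AllPairsₚ
open import Data.List.Relation.Unary.Any as Any using (Any; here; there)
open import Data.List.Relation.Unary.Any.Properties using (lookup-index)
open import Data.List.Relation.Unary.Unique.Propositional using (Unique)
import Data.List.Relation.Unary.Unique.Propositional.Properties as Unique
open import Data.Maybe using (Maybe; just; nothing)
import Data.Maybe as Maybe
open import Data.Maybe.Properties using (just-injective)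
import Data.Maybe.Properties as Maybe
open import Data.Nat as ℕ using (ℕ; zero; suc; _≤_; z≤n; s≤s; _+_; _*_; _∸_; _^_; _≤ᵇ_; _≡ᵇ_; _⊓_; ⌈_/2⌉; _!)
open import Data.Nat.Combinatorics
  using (_C_; nCk+nC[k+1]≡[n+1]C[k+1]; nCk≡nC[n∸k]; nCn≡1; nCk≡n!/k![n-k]!; k![n∸k]!∣n!)
open import Data.Nat.DivMod using (m/n*n≡m; m*n/n≡m; /-congˡ)
open import Data.Nat.Properties
  using (≡ᵇ⇒≡; ≡⇒≡ᵇ; ≤-pred; m⊓n≤m; m⊓n≤n; ≤⇒≤ᵇ; n≤1+n; m≤n⇒m≤1+n; ⊓-glb; +-mono-≤; _!≢0; m*n≢0
  ; *-assoc; m≤m+n; m+n∸m≡n; ≤ᵇ⇒≤; +-cancelˡ-≡; ≤-trans; ≤-refl; +-suc; +-comm; +-identityʳ; *-zeroʳ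
  ; *-distribˡ-+; m∸n+n≡m; m+n∸n≡m; +-∸-assoc; *-monoʳ-≤; m^n>0)
open import Data.Nat.Tactic.RingSolver using (solve-∀)
open import Data.Product using (∃; ∃₂; _×_; _,_; proj₁; proj₂; uncurry)
open import Data.Product.Properties using (,-injectiveʳ)
open import Data.Sum using (_⊎_; inj₁; inj₂)
open import Data.Vec as Vec using (Vec; []; _∷_; lookup)
open import Data.Vec.Functional using (updateAt)
open import Data.Vec.Functional.Properties using (updateAt-updates; updateAt-minimal)
open import Data.Vec.Properties
  using (∷-injectiveˡ; ∷-injectiveʳ; tabulate∘lookup; tabulate-cong; lookup∘update; lookup∘update′
  ; lookup-replicate)
open import Data.Vec.Relation.Unary.All as VecAll using ([]; _∷_)
open import Function using (const; case_of_; id; _∘_)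
open import Function.Bundles using (Equivalence)
open import Relation.Binary.PropositionalEquality
open import Relation.Nullary using (¬_; Dec; yes; no; does)

open import Defs

infix 4 _==_

_==_ : Bool → Bool → Bool
true  == true  = true
false == false = true
true  == false = false
false == true  = false

==-refl : ∀ c → (c == c) ≡ true
==-refl true  = refl
==-refl false = refl

==-not : ∀ c → (c == not c) ≡ false
==-not true  = refl
==-not false = refl

==⇒≡ : ∀ c d → (c == d) ≡ true → c ≡ d
==⇒≡ true  true  _ = refl
==⇒≡ false false _ = refl

==-false⇒≡not : ∀ c d → (c == d) ≡ false → d ≡ not c
==-false⇒≡not true  false _ = refl
==-false⇒≡not false true  _ = refl

anyFin : ∀ {n} → (Fin n → Bool) → Bool
anyFin {zero}  p = false
anyFin {suc n} p = p zero ∨ anyFin (λ k → p (suc k))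

anyFin-intro : ∀ {n} (p : Fin n → Bool) k → p k ≡ true → anyFin p ≡ true
anyFin-intro p zero    e rewrite e = refl
anyFin-intro p (suc k) e with p zero
... | true  = refl
... | false = anyFin-intro (λ k → p (suc k)) k e

anyFin-elim : ∀ {n} (p : Fin n → Bool) → anyFin p ≡ true → ∃ λ k → p k ≡ true
anyFin-elim {suc n} p e with p zero in eq
... | true  = zero , eq
... | false with anyFin-elim (λ k → p (suc k)) e
...   | k , e′ = suc k , e′

anyFin-none : ∀ {n} (p : Fin n → Bool) → (∀ k → p k ≡ false) → anyFin p ≡ false
anyFin-none {zero}  p h = refl
anyFin-none {suc n} p h rewrite h zero = anyFin-none (λ k → p (suc k)) (λ k → h (suc k))

anyFin-cong : ∀ {n} (p q : Fin n → Bool) → (∀ k → p k ≡ q k) → anyFin p ≡ anyFin q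
anyFin-cong {zero}  p q h = refl
anyFin-cong {suc n} p q h rewrite h zero = cong (q zero ∨_) (anyFin-cong _ _ (λ k → h (suc k)))

anyFin-false : ∀ {n} (p : Fin n → Bool) → anyFin p ≡ false → ∀ k → p k ≡ false
anyFin-false p e k with p k in eq
... | false = refl
... | true  = trans (sym (anyFin-intro p k eq)) e

∧-true⁻ : ∀ {a b} → a ∧ b ≡ true → a ≡ true × b ≡ true
∧-true⁻ {true} e = refl , e

∧-true⁺ : ∀ {a b} → a ≡ true → b ≡ true → a ∧ b ≡ true
∧-true⁺ refl refl = refl

≡true⇒T : ∀ {b} → b ≡ true → T b
≡true⇒T = Equivalence.from T-≡

T⇒≡true : ∀ {b} → T b → b ≡ true
T⇒≡true = Equivalence.to T-≡

lookup-ext : ∀ {a} {A : Set a} {n} (u v : Vec A n) → (∀ k → lookup u k ≡ lookup v k) → u ≡ v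
lookup-ext u v h = trans (sym (tabulate∘lookup u)) (trans (tabulate-cong h) (tabulate∘lookup v))

infixl 6 _[_]≔_

_[_]≔_ : ∀ {n} → (Fin n → Bool) → Fin n → Bool → Fin n → Bool
z [ k ]≔ v = updateAt z k (const v)

-- Layered functions

-- A layer records, for each variable in it, its canalising value.
Layer : ℕ → Set
Layer n = Vec (Maybe Bool) n

canalised : Maybe Bool → Bool → Bool
canalised nothing  y = false
canalised (just c) y = c == y

fires : ∀ {n} → Layer n → (Fin n → Bool) → Bool
fires L x = anyFin (λ k → canalised (lookup L k) (x k))

layered : ∀ {n} → Bool → List (Layer n) → BoolFun n
layered b []       x = b
layered b (L ∷ Ls) x = if fires L x then b else layered (not b) Ls x

fires-intro : ∀ {n} (L : Layer n) x k c → lookup L k ≡ just c → x k ≡ c → fires L x ≡ true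
fires-intro L x k c Lk xk = anyFin-intro _ k
  (subst (λ m → canalised m (x k) ≡ true) (sym Lk) (subst (λ y → (c == y) ≡ true) (sym xk) (==-refl c)))

fires-elim : ∀ {n} (L : Layer n) x → fires L x ≡ true → ∃ λ k → lookup L k ≡ just (x k)
fires-elim L x e with anyFin-elim _ e
... | k , h with lookup L k in eq
...   | just c = k , trans eq (cong just (==⇒≡ c (x k) h))

fires-none : ∀ {n} (L : Layer n) x → (∀ k c → lookup L k ≡ just c → x k ≡ not c) → fires L x ≡ false
fires-none L x h = anyFin-none _ λ k → miss k (lookup L k) refl
  where
  miss : ∀ k m → lookup L k ≡ m → canalised m (x k) ≡ false
  miss k nothing  e = refl
  miss k (just c) e rewrite h k c e = ==-not c

fires-frame : ∀ {n} (L : Layer n) x y → (∀ k c → lookup L k ≡ just c → x k ≡ y k) → fires L x ≡ fires L y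
fires-frame L x y h = anyFin-cong _ _ λ k → same k (lookup L k) refl
  where
  same : ∀ k m → lookup L k ≡ m → canalised m (x k) ≡ canalised m (y k)
  same k nothing  e = refl
  same k (just c) e rewrite h k c e = refl

layered-fires : ∀ {n} b (L : Layer n) Ls x → fires L x ≡ true → layered b (L ∷ Ls) x ≡ b
layered-fires b L Ls x e rewrite e = refl

layered-skip : ∀ {n} b (L : Layer n) Ls x → fires L x ≡ false → layered b (L ∷ Ls) x ≡ layered (not b) Ls x
layered-skip b L Ls x e rewrite e = refl

inLayer : Maybe Bool → Bool
inLayer nothing  = false
inLayer (just _) = true

size : ∀ {n} → Layer n → ℕ
size []            = 0
size (nothing ∷ L) = size L
size (just _ ∷ L)  = suc (size L)

-- Sets of variables are boolean vectors.
infixl 6 _∖_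

_∖_ : ∀ {n} → Vec Bool n → Layer n → Vec Bool n
[]      ∖ []      = []
(r ∷ R) ∖ (m ∷ L) = (r ∧ not (inLayer m)) ∷ (R ∖ L)

infix 4 _⊆_

_⊆_ : ∀ {n} → Layer n → Vec Bool n → Set
L ⊆ R = ∀ k c → lookup L k ≡ just c → lookup R k ≡ true

-- A single variable in the last layer could equally be moved, with the opposite
-- canalising value, into the layer before; requiring two makes layerings unique.
data Layering {n} : Vec Bool n → List (Layer n) → Set where
  done : ∀ {R} → (∀ k → lookup R k ≡ false) → Layering R []
  next : ∀ {R L Ls} → L ⊆ R → 1 ≤ size L → (Ls ≡ [] → 2 ≤ size L) →
         Layering (R ∖ L) Ls → Layering R (L ∷ Ls)

∖-true⁻ : ∀ {n} (R : Vec Bool n) L k → lookup (R ∖ L) k ≡ true → lookup R k ≡ true × lookup L k ≡ nothing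
∖-true⁻ (true ∷ R) (nothing ∷ L) zero    e = refl , refl
∖-true⁻ (r ∷ R)    (m ∷ L)       (suc k) e = ∖-true⁻ R L k e

∖-false : ∀ {n} (R : Vec Bool n) L k → lookup R k ≡ false → lookup (R ∖ L) k ≡ false
∖-false (false ∷ R) (m ∷ L) zero    e = refl
∖-false (r ∷ R)     (m ∷ L) (suc k) e = ∖-false R L k e

∖-removes : ∀ {n} (R : Vec Bool n) L k c → lookup L k ≡ just c → lookup (R ∖ L) k ≡ false
∖-removes (true  ∷ R) (just _ ∷ L) zero    c e = refl
∖-removes (false ∷ R) (just _ ∷ L) zero    c e = refl
∖-removes (r ∷ R)     (m ∷ L)      (suc k) c e = ∖-removes R L k c e

∖-keeps : ∀ {n} (R : Vec Bool n) L k → lookup R k ≡ true → lookup L k ≡ nothing → lookup (R ∖ L) k ≡ true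
∖-keeps (true ∷ R) (nothing ∷ L) zero    e₁ e₂ = refl
∖-keeps (r ∷ R)    (m ∷ L)       (suc k) e₁ e₂ = ∖-keeps R L k e₁ e₂

⊆-outside : ∀ {n} (R : Vec Bool n) L → L ⊆ R → ∀ k → lookup R k ≡ false → lookup L k ≡ nothing
⊆-outside R L sub k e with lookup L k in eq
... | nothing = refl
... | just c  with () ← trans (sym (sub k c eq)) e

layered-frame : ∀ {n} {R : Vec Bool n} {Ls} → Layering R Ls → ∀ b x y →
  (∀ k → lookup R k ≡ true → x k ≡ y k) → layered b Ls x ≡ layered b Ls y
layered-frame (done _) b x y h = refl
layered-frame {R = R} (next {L = L} sub _ _ v) b x y h
  rewrite fires-frame L x y (λ k c e → h k (sub k c e))
        | layered-frame v (not b) x y (λ k e → h k (proj₁ (∖-true⁻ R L k e))) = refl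

avoid : ∀ {n} → Layer n → (Fin n → Bool) → Fin n → Bool
avoid L z k with lookup L k
... | nothing = z k
... | just c  = not c

avoid-in : ∀ {n} (L : Layer n) z k c → lookup L k ≡ just c → avoid L z k ≡ not c
avoid-in L z k c e with lookup L k
avoid-in L z k c refl | just .c = refl

avoid-out : ∀ {n} (L : Layer n) z k → lookup L k ≡ nothing → avoid L z k ≡ z k
avoid-out L z k e with lookup L k
avoid-out L z k refl | nothing = refl

fires-avoid : ∀ {n} (L : Layer n) z → fires L (avoid L z) ≡ false
fires-avoid L z = fires-none L _ (avoid-in L z)

avoid-const : ∀ {n} (L : Layer n) c i → ¬ lookup L i ≡ just c → avoid L (const c) i ≡ c
avoid-const L c i ne with lookup L i
... | nothing = refl
... | just c′ = sym (¬-not (λ e → ne (cong just (sym e))))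

some-variable : ∀ {n} (L : Layer n) → 1 ≤ size L → ∃₂ λ k c → lookup L k ≡ just c
some-variable (nothing ∷ L) h with some-variable L h
... | k , c , e = suc k , c , e
some-variable (just c ∷ L) h = zero , c , refl

size-empty : ∀ {n} (L : Layer n) → (∀ k c → ¬ lookup L k ≡ just c) → size L ≡ 0
size-empty []            h = refl
size-empty (nothing ∷ L) h = size-empty L (λ k → h (suc k))
size-empty (just c ∷ L)  h = ⊥-elim (h zero c refl)

size-single : ∀ {n} (L : Layer n) i → (∀ k c → lookup L k ≡ just c → k ≡ i) → size L ≤ 1
size-single (nothing ∷ L) zero h rewrite size-empty L (λ k c e → 0≢1+n (sym (h (suc k) c e))) = z≤n
size-single (just c ∷ L)  zero h rewrite size-empty L (λ k c e → 0≢1+n (sym (h (suc k) c e))) = s≤s z≤n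
size-single (nothing ∷ L) (suc i) h = size-single L i (λ k c e → suc-injective (h (suc k) c e))
size-single (just c ∷ L)  (suc i) h with () ← h zero c refl

other-or-only : ∀ {n} (L : Layer n) i →
  (∃₂ λ k c → lookup L k ≡ just c × ¬ k ≡ i) ⊎ (∀ k c → lookup L k ≡ just c → k ≡ i)
other-or-only L i with anyFin (λ k → inLayer (lookup L k) ∧ not (does (k ≟ i))) in found
... | true with anyFin-elim _ found
...   | k , h with lookup L k in Lk | k ≟ i
...     | just c | no k≢i = inj₁ (k , c , Lk , k≢i)
other-or-only L i | false = inj₂ λ k c Lk → only k c Lk (anyFin-false _ found k)
  where
  only : ∀ k c → lookup L k ≡ just c → inLayer (lookup L k) ∧ not (does (k ≟ i)) ≡ false → k ≡ i
  only k c Lk h rewrite Lk with k ≟ i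
  ... | yes k≡i = k≡i

single-layer-not-last : ∀ {n} {L : Layer n} i → (∀ k c → lookup L k ≡ just c → k ≡ i) → ¬ 2 ≤ size L
single-layer-not-last {L = L} i only two with s≤s () ← ≤-trans two (size-single L i only)

first-nonempty : ∀ {n} {R : Vec Bool n} {L Ls} → Layering R (L ∷ Ls) → 1 ≤ size L
first-nonempty (next _ nonempty _ _) = nonempty

first-⊆ : ∀ {n} {R : Vec Bool n} {L Ls} → Layering R (L ∷ Ls) → L ⊆ R
first-⊆ (next sub _ _ _) = sub

mutual
  reach-head : ∀ {n} {R : Vec Bool n} {Ls} → Layering R Ls → ∀ b i z →
    ∃ λ y → y i ≡ z i × (∀ k → lookup R k ≡ false → y k ≡ z k) × layered b Ls y ≡ b
  reach-head (done _) b i z = z , refl , (λ _ _ → refl) , refl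
  reach-head {R = R} (next {L = L} {Ls} sub nonempty last tail) b i z with other-or-only L i
  ... | inj₁ (k , c , Lk , k≢i) =
    z [ k ]≔ c , updateAt-minimal i k z (λ e → k≢i (sym e)) , outside ,
    layered-fires b L Ls _ (fires-intro L _ k c Lk (updateAt-updates k z))
    where
    outside : ∀ j → lookup R j ≡ false → (z [ k ]≔ c) j ≡ z j
    outside j e = updateAt-minimal j k z λ { refl → not-¬ refl (trans (sym (sub j c Lk)) e) }
  ... | inj₂ only with some-variable L nonempty
  ...   | k , c , Lk with refl ← only k c Lk with c Data.Bool.≟ z k
  ...     | yes c≡zk = z , refl , (λ _ _ → refl) , layered-fires b L Ls z (fires-intro L z k c Lk (sym c≡zk))
  ...     | no c≢zk = through-second Ls last tail
    where
    through-second : ∀ Ls → (Ls ≡ [] → 2 ≤ size L) → Layering (R ∖ L) Ls →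
      ∃ λ y → y k ≡ z k × (∀ j → lookup R j ≡ false → y j ≡ z j) × layered b (L ∷ Ls) y ≡ b
    through-second [] last _ = ⊥-elim (single-layer-not-last {L = L} k only (last refl))
    through-second (T ∷ Ls′) _ tail with beyond-head tail (not b) k z
    ... | y , yk , yout , _ , value =
      y , yk′ , (λ j e → yout j (∖-false R L j e)) ,
      trans (layered-skip b L (T ∷ Ls′) y (fires-none L y missL)) (trans value (not-involutive b))
      where
      yk′ : y k ≡ z k
      yk′ = trans yk (avoid-out T z k (⊆-outside (R ∖ L) T (first-⊆ tail) k (∖-removes R L k c Lk)))
      missL : ∀ j c′ → lookup L j ≡ just c′ → y j ≡ not c′
      missL j c′ Lj with refl ← only j c′ Lj =
        trans yk′ (trans (¬-not (λ e → c≢zk (sym e))) (cong not (just-injective (trans (sym Lk) Lj))))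

  beyond-head : ∀ {n} {R : Vec Bool n} {L Ls} → Layering R (L ∷ Ls) → ∀ b i z →
    ∃ λ y → y i ≡ avoid L z i × (∀ k → lookup R k ≡ false → y k ≡ z k) ×
            (∀ k c → lookup L k ≡ just c → y k ≡ not c) × layered b (L ∷ Ls) y ≡ not b
  beyond-head {R = R} {L} {Ls} (next sub _ _ tail) b i z with reach-head tail (not b) i (avoid L z)
  ... | y , yi , yout , value = y , yi , outside , missL , trans (layered-skip b L Ls y (fires-none L y missL)) value
    where
    missL : ∀ k c → lookup L k ≡ just c → y k ≡ not c
    missL k c Lk = trans (yout k (∖-removes R L k c Lk)) (avoid-in L z k c Lk)
    outside : ∀ k → lookup R k ≡ false → y k ≡ z k
    outside k e = trans (yout k (∖-false R L k e)) (avoid-out L z k (⊆-outside R L sub k e))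

CanalisingInput : ∀ {n} → BoolFun n → Fin n → Bool → Set
CanalisingInput f i c = ∀ x y → x i ≡ c → y i ≡ c → f x ≡ f y

first-layer⇒canalising : ∀ {n} (L : Layer n) Ls b i c → lookup L i ≡ just c →
  CanalisingInput (layered b (L ∷ Ls)) i c
first-layer⇒canalising L Ls b i c Li x y xi yi =
  trans (layered-fires b L Ls x (fires-intro L x i c Li xi)) (sym (layered-fires b L Ls y (fires-intro L y i c Li yi)))

canalising⇒first-layer : ∀ {n} {R : Vec Bool n} {L Ls} → Layering R (L ∷ Ls) → ∀ b i c →
  CanalisingInput (layered b (L ∷ Ls)) i c → lookup L i ≡ just c
canalising⇒first-layer {R = R} {L} {Ls} V@(next sub nonempty last tail) b i c canalising
  with Maybe.≡-dec Data.Bool._≟_ (lookup L i) (just c)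
... | yes Li = Li
... | no Li≢c with other-or-only L i
...   | inj₁ (k , c₀ , Lk , k≢i) with y , yi , _ , _ , fy ← beyond-head V b i (const c) =
  ⊥-elim (not-¬ refl (trans (sym fx) (trans (canalising x y xi (trans yi (avoid-const L c i Li≢c))) fy)))
  where
  x = const c [ k ]≔ c₀
  xi : x i ≡ c
  xi = updateAt-minimal i k (const c) (λ e → k≢i (sym e))
  fx : layered b (L ∷ Ls) x ≡ b
  fx = layered-fires b L Ls x (fires-intro L x k c₀ Lk (updateAt-updates k (const c)))
...   | inj₂ only with some-variable L nonempty
...     | k , c′ , Lk with refl ← only k c′ Lk = ⊥-elim (through-second Ls last tail canalising)
  where
  through-second : ∀ Ls → (Ls ≡ [] → 2 ≤ size L) → Layering (R ∖ L) Ls →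
    CanalisingInput (layered b (L ∷ Ls)) k c → ⊥
  through-second [] last _ _ = single-layer-not-last {L = L} k only (last refl)
  through-second (T ∷ Ls′) last tail canalising
    with x , xk , _ , _ , fx ← beyond-head (next sub nonempty last tail) b k (const c)
       | y , yk , yout , _ , fy ← beyond-head tail (not b) k (avoid L (const c)) =
    not-¬ refl (trans (sym fy′) (trans (canalising y x yk′ (trans xk (avoid-const L c k Li≢c))) fx))
    where
    yk′ : y k ≡ c
    yk′ = trans (yout k (∖-removes R L k c′ Lk)) (avoid-const L c k Li≢c)
    missL : ∀ j c″ → lookup L j ≡ just c″ → y j ≡ not c″
    missL j c″ Lj with refl ← only j c″ Lj = trans (yout j (∖-removes R L j c″ Lj)) (avoid-in L (const c) j c″ Lj)
    fy′ : layered b (L ∷ T ∷ Ls′) y ≡ b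
    fy′ = trans (layered-skip b L (T ∷ Ls′) y (fires-none L y missL)) (trans fy (not-involutive b))

layered-nonconstant : ∀ {n} {R : Vec Bool n} {L Ls} → Layering R (L ∷ Ls) → ∀ b →
  ∃₂ λ x y → layered b (L ∷ Ls) x ≡ b × layered b (L ∷ Ls) y ≡ not b
layered-nonconstant {L = L} {Ls} V b
  with k , c , Lk ← some-variable L (first-nonempty V)
  with y , _ , _ , _ , fy ← beyond-head V b k (const c) =
  const c , y , layered-fires b L Ls _ (fires-intro L _ k c Lk refl) , fy

same-first-layer : ∀ {n} {R : Vec Bool n} {L L′ Ls Ls′} → Layering R (L ∷ Ls) → Layering R (L′ ∷ Ls′) → ∀ b b′ →
  (∀ x → layered b (L ∷ Ls) x ≡ layered b′ (L′ ∷ Ls′) x) → L ≡ L′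
same-first-layer {L = L} {L′} {Ls} {Ls′} V V′ b b′ same = lookup-ext L L′ same-entry
  where
  same-entry : ∀ k → lookup L k ≡ lookup L′ k
  same-entry k with lookup L k in Lk
  ... | just c = sym (canalising⇒first-layer V′ b′ k c λ x y xk yk →
                   trans (sym (same x)) (trans (first-layer⇒canalising L Ls b k c Lk x y xk yk) (same y)))
  ... | nothing with lookup L′ k in L′k
  ...   | just c = trans (sym Lk) (canalising⇒first-layer V b k c λ x y xk yk →
                     trans (same x) (trans (first-layer⇒canalising L′ Ls′ b′ k c L′k x y xk yk) (sym (same y))))
  ...   | nothing = refl

layered-injective : ∀ {n} {R : Vec Bool n} {Ls Ls′} → Layering R Ls → Layering R Ls′ → ∀ b b′ →
  (∀ x → layered b Ls x ≡ layered b′ Ls′ x) → b ≡ b′ × Ls ≡ Ls′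
layered-injective (done _) (done _) b b′ same = same (const true) , refl
layered-injective (done _) V@(next _ _ _ _) b b′ same with layered-nonconstant V b′
... | x , y , fx , fy = ⊥-elim (not-¬ refl (trans (sym (trans (same x) fx)) (trans (same y) fy)))
layered-injective V@(next _ _ _ _) (done _) b b′ same with layered-nonconstant V b
... | x , y , fx , fy = ⊥-elim (not-¬ refl (trans (sym (trans (sym (same x)) fx)) (trans (sym (same y)) fy)))
layered-injective {R = R} V@(next {L = L} {Ls} _ _ _ tail) V′@(next {Ls = Ls′} _ _ _ tail′) b b′ same
  with refl ← same-first-layer V V′ b b′ same
  = b≡b′ , cong (L ∷_) (proj₂ (layered-injective tail tail′ (not b) (not b) same-tail))
  where
  b≡b′ : b ≡ b′
  b≡b′ with k , c , Lk ← some-variable L (first-nonempty V) =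
    trans (sym (layered-fires b L Ls _ (fires-intro L _ k c Lk refl)))
          (trans (same (const c)) (layered-fires b′ L Ls′ _ (fires-intro L _ k c Lk refl)))
  same-tail : ∀ x → layered (not b) Ls x ≡ layered (not b) Ls′ x
  same-tail x = begin
    layered (not b) Ls x    ≡⟨ layered-frame tail (not b) x x′ agree ⟩
    layered (not b) Ls x′   ≡⟨ sym (layered-skip b L Ls x′ (fires-avoid L x)) ⟩
    layered b (L ∷ Ls) x′   ≡⟨ same x′ ⟩
    layered b′ (L ∷ Ls′) x′ ≡⟨ layered-skip b′ L Ls′ x′ (fires-avoid L x) ⟩
    layered (not b′) Ls′ x′ ≡⟨ cong (λ c → layered (not c) Ls′ x′) (sym b≡b′) ⟩
    layered (not b) Ls′ x′  ≡⟨ sym (layered-frame tail′ (not b) x x′ agree) ⟩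
    layered (not b) Ls′ x   ∎
    where
    open ≡-Reasoning
    x′ = avoid L x
    agree : ∀ k → lookup (R ∖ L) k ≡ true → x k ≡ x′ k
    agree k e = sym (avoid-out L x k (proj₂ (∖-true⁻ R L k e)))

-- Symmetry classes of layered functions

data SwapView {n} (i j k : Fin n) : Set where
  at-i      : k ≡ i → SwapView i j k
  at-j      : ¬ k ≡ i → k ≡ j → SwapView i j k
  elsewhere : ¬ k ≡ i → ¬ k ≡ j → SwapView i j k

swapView : ∀ {n} (i j k : Fin n) → SwapView i j k
swapView i j k with k ≟ i
... | yes k≡i = at-i k≡i
... | no k≢i with k ≟ j
...   | yes k≡j = at-j k≢i k≡j
...   | no k≢j  = elsewhere k≢i k≢j

transpose-at-i : ∀ {n} (i j : Fin n) → transpose i j i ≡ j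
transpose-at-i i j with i ≟ i
... | yes _ = refl
... | no i≢i = ⊥-elim (i≢i refl)

transpose-at-j : ∀ {n} (i j : Fin n) → transpose i j j ≡ i
transpose-at-j i j with j ≟ i
... | yes refl = refl
... | no _ with j ≟ j
...   | yes _ = refl
...   | no j≢j = ⊥-elim (j≢j refl)

transpose-elsewhere : ∀ {n} (i j k : Fin n) → ¬ k ≡ i → ¬ k ≡ j → transpose i j k ≡ k
transpose-elsewhere i j k k≢i k≢j with k ≟ i
... | yes k≡i = ⊥-elim (k≢i k≡i)
... | no _ with k ≟ j
...   | yes k≡j = ⊥-elim (k≢j k≡j)
...   | no _ = refl

transpose-comm : ∀ {n} (i j k : Fin n) → transpose i j k ≡ transpose j i k
transpose-comm i j k with swapView i j k
... | at-i refl      = trans (transpose-at-i k j) (sym (transpose-at-j j k))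
... | at-j _ refl    = trans (transpose-at-j i k) (sym (transpose-at-i k i))
... | elsewhere a b  = trans (transpose-elsewhere i j k a b) (sym (transpose-elsewhere j i k b a))

transpose-involutive : ∀ {n} (i j k : Fin n) → transpose i j (transpose i j k) ≡ k
transpose-involutive i j k = trans (cong (transpose i j) (transpose-comm i j k)) (transpose-inverse i j)

lookup-transpose : ∀ {a} {A : Set a} {n} (L : Vec A n) i j → lookup L i ≡ lookup L j →
  ∀ k → lookup L (transpose i j k) ≡ lookup L k
lookup-transpose L i j Li≡Lj k with swapView i j k
... | at-i refl     rewrite transpose-at-i k j = sym Li≡Lj
... | at-j _ refl   rewrite transpose-at-j i k = Li≡Lj
... | elsewhere a b rewrite transpose-elsewhere i j k a b = refl

bool-ext : ∀ {a b : Bool} → (a ≡ true → b ≡ true) → (b ≡ true → a ≡ true) → a ≡ b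
bool-ext {true}  {true}  _ _ = refl
bool-ext {true}  {false} f _ = sym (f refl)
bool-ext {false} {true}  _ g = g refl
bool-ext {false} {false} _ _ = refl

fires-transpose : ∀ {n} (L : Layer n) i j x → lookup L i ≡ lookup L j →
  fires L (λ k → x (transpose i j k)) ≡ fires L x
fires-transpose L i j x Li≡Lj = bool-ext to from
  where
  to : fires L (λ k → x (transpose i j k)) ≡ true → fires L x ≡ true
  to h with k , Lk ← fires-elim L _ h =
    fires-intro L x (transpose i j k) _ (trans (lookup-transpose L i j Li≡Lj k) Lk) refl
  from : fires L x ≡ true → fires L (λ k → x (transpose i j k)) ≡ true
  from h with k , Lk ← fires-elim L _ h =
    fires-intro L _ (transpose i j k) (x k) (trans (lookup-transpose L i j Li≡Lj k) Lk)
      (cong x (transpose-involutive i j k))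

SameLayers : ∀ {n} → List (Layer n) → Fin n → Fin n → Set
SameLayers Ls i j = All (λ L → lookup L i ≡ lookup L j) Ls

same⇒∼ : ∀ {n} b (Ls : List (Layer n)) i j → SameLayers Ls i j → i ∼⟨ layered b Ls ⟩ j
same⇒∼ b []       i j []         x = refl
same⇒∼ b (L ∷ Ls) i j (e ∷ same) x rewrite fires-transpose L i j x e | same⇒∼ (not b) Ls i j same x = refl

outside⇒same : ∀ {n} {R : Vec Bool n} {Ls} → Layering R Ls → ∀ i j →
  lookup R i ≡ false → lookup R j ≡ false → SameLayers Ls i j
outside⇒same (done _) i j _ _ = []
outside⇒same {R = R} (next {L = L} sub _ _ tail) i j Ri Rj =
  trans (⊆-outside R L sub i Ri) (sym (⊆-outside R L sub j Rj)) ∷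
  outside⇒same tail i j (∖-false R L i Ri) (∖-false R L j Rj)

-- x fires the first layer at i, while x ∘ transpose i j is w, which fires no
-- variable of the first layer.
first-layer-asymmetric : ∀ {n} {R : Vec Bool n} {L Ls} → Layering R (L ∷ Ls) → ∀ b i j c →
  lookup L i ≡ just c → ¬ lookup L j ≡ just c → ¬ i ∼⟨ layered b (L ∷ Ls) ⟩ j
first-layer-asymmetric {R = R} {L} {Ls} V@(next _ _ _ tail) b i j c Li Lj≢c symmetric =
  not-¬ refl (trans (sym fx) (trans (sym (symmetric x)) (trans fxτ fw)))
  where
  i≢j : ¬ i ≡ j
  i≢j refl = Lj≢c Li
  z = avoid L (const true) [ j ]≔ c
  reached = reach-head tail (not b) j z
  w = proj₁ reached
  wj : w j ≡ c
  wj = trans (proj₁ (proj₂ reached)) (updateAt-updates j _)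
  w-outside : ∀ k → lookup (R ∖ L) k ≡ false → w k ≡ z k
  w-outside = proj₁ (proj₂ (proj₂ reached))
  wi : w i ≡ not c
  wi = trans (w-outside i (∖-removes R L i c Li)) (trans (updateAt-minimal i j _ i≢j) (avoid-in L _ i c Li))
  x = w [ i ]≔ c [ j ]≔ not c
  xi : x i ≡ c
  xi = trans (updateAt-minimal i j _ i≢j) (updateAt-updates i w)
  fx : layered b (L ∷ Ls) x ≡ b
  fx = layered-fires b L Ls x (fires-intro L x i c Li xi)
  xτ≡w : ∀ k → x (transpose i j k) ≡ w k
  xτ≡w k with swapView i j k
  ... | at-i refl     rewrite transpose-at-i k j = trans (updateAt-updates j _) (sym wi)
  ... | at-j _ refl   rewrite transpose-at-j i k = trans xi (sym wj)
  ... | elsewhere k≢i k≢j rewrite transpose-elsewhere i j k k≢i k≢j =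
    trans (updateAt-minimal k j _ k≢j) (updateAt-minimal k i w k≢i)
  missL : ∀ k c′ → lookup L k ≡ just c′ → w k ≡ not c′
  missL k c′ Lk with k ≟ j
  ... | yes refl = trans wj (¬-not (λ e → Lj≢c (trans Lk (cong just (sym e)))))
  ... | no k≢j = trans (w-outside k (∖-removes R L k c′ Lk))
                       (trans (updateAt-minimal k j _ k≢j) (avoid-in L _ k c′ Lk))
  fxτ : layered b (L ∷ Ls) (λ k → x (transpose i j k)) ≡ layered b (L ∷ Ls) w
  fxτ = layered-frame V b _ w (λ k _ → xτ≡w k)
  fw : layered b (L ∷ Ls) w ≡ not b
  fw = trans (layered-skip b L Ls w (fires-none L w missL)) (proj₂ (proj₂ (proj₂ reached)))

∼⇒same : ∀ {n} {R : Vec Bool n} {Ls} → Layering R Ls → ∀ b i j → i ∼⟨ layered b Ls ⟩ j → SameLayers Ls i j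
∼⇒same (done _) b i j _ = []
∼⇒same {R = R} V@(next {L = L} {Ls} _ _ _ tail) b i j symmetric
  with lookup L i in Li | lookup L j in Lj
... | just c | just c′ with c Data.Bool.≟ c′
...   | yes refl = trans Li (sym Lj) ∷ outside⇒same tail i j (∖-removes R L i _ Li) (∖-removes R L j _ Lj)
...   | no c≢c′ = ⊥-elim (first-layer-asymmetric V b i j c Li (λ e → c≢c′ (just-injective (trans (sym e) Lj))) symmetric)
∼⇒same V b i j symmetric | just c | nothing =
  ⊥-elim (first-layer-asymmetric V b i j c Li (λ e → case (trans (sym Lj) e) of λ ()) symmetric)
∼⇒same V@(next {L = L} {Ls} _ _ _ _) b i j symmetric | nothing | just c =
  ⊥-elim (first-layer-asymmetric V b j i c Lj (λ e → case (trans (sym Li) e) of λ ()) symmetric′)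
  where
  symmetric′ : j ∼⟨ layered b (L ∷ Ls) ⟩ i
  symmetric′ x = trans (layered-frame V b _ _ (λ k _ → cong x (transpose-comm j i k))) (symmetric x)
∼⇒same {R = R} V@(next {L = L} {Ls} _ _ _ tail) b i j symmetric | nothing | nothing =
  Li≡Lj ∷ ∼⇒same tail (not b) i j tail-symmetric
  where
  Li≡Lj : lookup L i ≡ lookup L j
  Li≡Lj = trans Li (sym Lj)
  tail-symmetric : i ∼⟨ layered (not b) Ls ⟩ j
  tail-symmetric x = begin
    layered (not b) Ls (λ k → x (transpose i j k))    ≡⟨ layered-frame tail (not b) _ _ agreeτ ⟩
    layered (not b) Ls (λ k → x′ (transpose i j k))   ≡⟨ sym (layered-skip b L Ls _ (trans (fires-transpose L i j x′ Li≡Lj) (fires-avoid L x))) ⟩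
    layered b (L ∷ Ls) (λ k → x′ (transpose i j k))   ≡⟨ symmetric x′ ⟩
    layered b (L ∷ Ls) x′                             ≡⟨ layered-skip b L Ls x′ (fires-avoid L x) ⟩
    layered (not b) Ls x′                             ≡⟨ sym (layered-frame tail (not b) x x′ agree) ⟩
    layered (not b) Ls x                              ∎
    where
    open ≡-Reasoning
    x′ = avoid L x
    agree : ∀ k → lookup (R ∖ L) k ≡ true → x k ≡ x′ k
    agree k e = sym (avoid-out L x k (proj₂ (∖-true⁻ R L k e)))
    agreeτ : ∀ k → lookup (R ∖ L) k ≡ true → x (transpose i j k) ≡ x′ (transpose i j k)
    agreeτ k e = sym (avoid-out L x _ (trans (lookup-transpose L i j Li≡Lj k) (proj₂ (∖-true⁻ R L k e))))

-- A variable of the m-th layer (from 0) with canalising value c has label (m , c).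
Label : Set
Label = ℕ × Bool

shift : Label → Label
shift (m , c) = suc m , c

shift-injective : ∀ {u v} → shift u ≡ shift v → u ≡ v
shift-injective refl = refl

label : ∀ {n} → List (Layer n) → Fin n → Maybe Label
label []       i = nothing
label (L ∷ Ls) i with lookup L i
... | just c  = just (0 , c)
... | nothing = Maybe.map shift (label Ls i)

hasValue : ∀ {n} → Layer n → Bool → Bool
hasValue L c = fires L (const c)

[_]if_ : Label → Bool → List Label
[ u ]if true  = u ∷ []
[ u ]if false = []

layerLabels : ∀ {n} → Layer n → List Label
layerLabels L = [ 0 , true ]if hasValue L true ++ [ 0 , false ]if hasValue L false

labels : ∀ {n} → List (Layer n) → List Label
labels []       = []
labels (L ∷ Ls) = layerLabels L ++ List.map shift (labels Ls)

classes : ∀ {n} → List (Layer n) → ℕ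
classes Ls = length (labels Ls)

∈-[]if : ∀ u {b} → b ≡ true → u ∈ [ u ]if b
∈-[]if u refl = here refl

∈-[]if⁻ : ∀ u b {v} → v ∈ [ u ]if b → b ≡ true × v ≡ u
∈-[]if⁻ u true (here v≡u) = refl , v≡u

label-first : ∀ {n} (L : Layer n) Ls i c → lookup L i ≡ just c → label (L ∷ Ls) i ≡ just (0 , c)
label-first L Ls i c e with lookup L i
label-first L Ls i c refl | just .c = refl

label-later : ∀ {n} (L : Layer n) Ls i → lookup L i ≡ nothing → label (L ∷ Ls) i ≡ Maybe.map shift (label Ls i)
label-later L Ls i e with lookup L i
label-later L Ls i refl | nothing = refl

map-shift-just : ∀ (m : Maybe Label) {u} → Maybe.map shift m ≡ just u → ∃ λ u′ → m ≡ just u′ × u ≡ shift u′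
map-shift-just (just u′) refl = u′ , refl , refl

label∈labels : ∀ {n} (Ls : List (Layer n)) i u → label Ls i ≡ just u → u ∈ labels Ls
label∈labels (L ∷ Ls) i u e with lookup L i in Li
label∈labels (L ∷ Ls) i u refl | just true =
  ∈-++⁺ˡ (∈-++⁺ˡ (∈-[]if _ (fires-intro L _ i true Li refl)))
label∈labels (L ∷ Ls) i u refl | just false =
  ∈-++⁺ˡ (∈-++⁺ʳ ([ 0 , true ]if hasValue L true) (∈-[]if _ (fires-intro L _ i false Li refl)))
label∈labels (L ∷ Ls) i u e | nothing with u′ , e′ , refl ← map-shift-just (label Ls i) e =
  ∈-++⁺ʳ (layerLabels L) (∈-map⁺ shift (label∈labels Ls i u′ e′))

label⇒∈ : ∀ {n} {R : Vec Bool n} {Ls} → Layering R Ls → ∀ i u → label Ls i ≡ just u → lookup R i ≡ true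
label⇒∈ {R = R} (next {L = L} {Ls} sub _ _ tail) i u e with lookup L i in Li
... | just c = sub i c Li
... | nothing with u′ , e′ , _ ← map-shift-just (label Ls i) e = proj₁ (∖-true⁻ R L i (label⇒∈ tail i u′ e′))

labels⇒label : ∀ {n} {R : Vec Bool n} {Ls} → Layering R Ls → ∀ u → u ∈ labels Ls → ∃ λ i → label Ls i ≡ just u
labels⇒label {R = R} (next {L = L} {Ls} _ _ _ tail) u u∈ with ∈-++⁻ (layerLabels L) u∈
... | inj₁ u∈L = first-layer-value (∈-++⁻ ([ 0 , true ]if hasValue L true) u∈L)
  where
  found : ∀ c → hasValue L c ≡ true → ∃ λ i → label (L ∷ Ls) i ≡ just (0 , c)
  found c has with i , Li ← fires-elim L _ has = i , label-first L Ls i c Li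
  first-layer-value : u ∈ [ 0 , true ]if hasValue L true ⊎ u ∈ [ 0 , false ]if hasValue L false →
                      ∃ λ i → label (L ∷ Ls) i ≡ just u
  first-layer-value (inj₁ u∈) with has , refl ← ∈-[]if⁻ _ _ u∈ = found true has
  first-layer-value (inj₂ u∈) with has , refl ← ∈-[]if⁻ _ _ u∈ = found false has
... | inj₂ u∈Ls with u′ , u′∈ , refl ← ∈-map⁻ shift u∈Ls with i , e ← labels⇒label tail u′ u′∈ =
  i , trans (label-later L Ls i (proj₂ (∖-true⁻ R L i (label⇒∈ tail i u′ e)))) (cong (Maybe.map shift) e)

label⇒same : ∀ {n} {R : Vec Bool n} {Ls} → Layering R Ls → ∀ i j u →
  label Ls i ≡ just u → label Ls j ≡ just u → SameLayers Ls i j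
label⇒same (done _) i j u _ _ = []
label⇒same {R = R} (next {L = L} {Ls} _ _ _ tail) i j u ei ej with lookup L i in Li | lookup L j in Lj
... | just c | just c′ with refl ← trans ei (sym ej) =
  trans Li (sym Lj) ∷ outside⇒same tail i j (∖-removes R L i _ Li) (∖-removes R L j _ Lj)
... | just c | nothing with _ , _ , () ← map-shift-just (label Ls j) (trans ej (sym ei))
... | nothing | just c with _ , _ , () ← map-shift-just (label Ls i) (trans ei (sym ej))
... | nothing | nothing with a , ea , refl ← map-shift-just (label Ls i) ei | b , eb , e ← map-shift-just (label Ls j) ej
  with refl ← shift-injective e = trans Li (sym Lj) ∷ label⇒same tail i j a ea eb

same⇒label : ∀ {n} (Ls : List (Layer n)) i j → SameLayers Ls i j → label Ls i ≡ label Ls j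
same⇒label []       i j []         = refl
same⇒label (L ∷ Ls) i j (e ∷ same) with lookup L i | lookup L j
same⇒label (L ∷ Ls) i j (refl ∷ same) | just c  | .(just c) = refl
same⇒label (L ∷ Ls) i j (refl ∷ same) | nothing | .nothing  = cong (Maybe.map shift) (same⇒label Ls i j same)

labelled : ∀ {n} {R : Vec Bool n} {Ls} → Layering R Ls → ∀ i → lookup R i ≡ true → ∃ λ u → label Ls i ≡ just u
labelled (done outside) i Ri with () ← trans (sym Ri) (outside i)
labelled {R = R} (next {L = L} {Ls} _ _ _ tail) i Ri with lookup L i in Li
... | just c  = (0 , c) , refl
... | nothing with u , e ← labelled tail i (∖-keeps R L i Ri Li) = shift u , cong (Maybe.map shift) e

labels-unique : ∀ {n} (Ls : List (Layer n)) → Unique (labels Ls)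
labels-unique []       = []
labels-unique (L ∷ Ls) = Unique.++⁺ (Unique.++⁺ (unique-[]if _ _) (unique-[]if _ _) true≢false)
                                     (Unique.map⁺ shift-injective (labels-unique Ls)) first≢later
  where
  unique-[]if : ∀ u b → Unique ([ u ]if b)
  unique-[]if u true  = [] ∷ []
  unique-[]if u false = []
  true≢false : ∀ {u} → ¬ (u ∈ [ 0 , true ]if hasValue L true × u ∈ [ 0 , false ]if hasValue L false)
  true≢false (u∈ , u∈′) with _ , refl ← ∈-[]if⁻ _ _ u∈ with () ← ∈-[]if⁻ _ _ u∈′
  first≢later : ∀ {u} → ¬ (u ∈ layerLabels L × u ∈ List.map shift (labels Ls))
  first≢later (u∈ , u∈′) with _ , _ , refl ← ∈-map⁻ shift u∈′
                         with ∈-++⁻ ([ 0 , true ]if hasValue L true) u∈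
  ... | inj₁ u∈t with () ← proj₂ (∈-[]if⁻ _ _ u∈t)
  ... | inj₂ u∈f with () ← proj₂ (∈-[]if⁻ _ _ u∈f)

lookup-injective : ∀ {A B : Set} (g : A → B) {xs} → AllPairs (λ a b → ¬ g a ≡ g b) xs →
  ∀ p q → g (List.lookup xs p) ≡ g (List.lookup xs q) → p ≡ q
lookup-injective g (_ ∷ _) zero zero e = refl
lookup-injective g {x ∷ xs} (x≢ ∷ _) zero (suc q) e = ⊥-elim (All.lookup x≢ (∈-lookup q) e)
lookup-injective g {x ∷ xs} (x≢ ∷ _) (suc p) zero e = ⊥-elim (All.lookup x≢ (∈-lookup p) (sym e))
lookup-injective g (_ ∷ distinct) (suc p) (suc q) e = cong suc (lookup-injective g distinct p q e)

module _ {n} {R : Vec Bool n} {Ls} (V : Layering R Ls) (full : ∀ k → lookup R k ≡ true) (b : Bool) where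

  private
    labelOf : Fin n → Label
    labelOf i = proj₁ (labelled V i (full i))

    label≡labelOf : ∀ i → label Ls i ≡ just (labelOf i)
    label≡labelOf i = proj₂ (labelled V i (full i))

    position : Fin n → Fin (classes Ls)
    position i = Any.index (label∈labels Ls i _ (label≡labelOf i))

    labelOf≡lookup : ∀ i → labelOf i ≡ List.lookup (labels Ls) (position i)
    labelOf≡lookup i = lookup-index (label∈labels Ls i _ (label≡labelOf i))

    ∼⇒same-label : ∀ i j → i ∼⟨ layered b Ls ⟩ j → labelOf i ≡ labelOf j
    ∼⇒same-label i j i∼j = just-injective
      (trans (sym (label≡labelOf i)) (trans (same⇒label Ls i j (∼⇒same V b i j i∼j)) (label≡labelOf j)))

    same-label⇒∼ : ∀ i j → labelOf i ≡ labelOf j → i ∼⟨ layered b Ls ⟩ j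
    same-label⇒∼ i j e = same⇒∼ b Ls i j (label⇒same V i j _ (label≡labelOf i) (trans (label≡labelOf j) (cong just (sym e))))

    carrier : Fin (classes Ls) → Fin n
    carrier q = proj₁ (labels⇒label V _ (∈-lookup q))

    labelOf-carrier : ∀ q → labelOf (carrier q) ≡ List.lookup (labels Ls) q
    labelOf-carrier q = just-injective (trans (sym (label≡labelOf _)) (proj₂ (labels⇒label V _ (∈-lookup q))))

    lookup-labels-injective : ∀ p q → List.lookup (labels Ls) p ≡ List.lookup (labels Ls) q → p ≡ q
    lookup-labels-injective = lookup-injective id (labels-unique Ls)

  classes-symmetric : IsSSymmetric (classes Ls) (layered b Ls)
  classes-symmetric = carrier , distinct , covering
    where
    distinct : ∀ p q → ¬ p ≡ q → ¬ carrier p ∼⟨ layered b Ls ⟩ carrier q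
    distinct p q p≢q p∼q = p≢q (lookup-labels-injective p q
      (trans (sym (labelOf-carrier p)) (trans (∼⇒same-label _ _ p∼q) (labelOf-carrier q))))
    covering : ∀ i → ∃ λ p → i ∼⟨ layered b Ls ⟩ carrier p
    covering i = position i , same-label⇒∼ _ _ (trans (labelOf≡lookup i) (sym (labelOf-carrier (position i))))

  symmetric⇒classes : ∀ s → IsSSymmetric s (layered b Ls) → s ≡ classes Ls
  symmetric⇒classes s (rep , distinct , covering) = cantor-schröder-bernstein g-injective h-injective
    where
    g : Fin s → Fin (classes Ls)
    g p = position (rep p)
    g-injective : ∀ {p q} → g p ≡ g q → p ≡ q
    g-injective {p} {q} e with p ≟ q
    ... | yes p≡q = p≡q
    ... | no p≢q = ⊥-elim (distinct p q p≢q (same-label⇒∼ _ _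
                    (trans (labelOf≡lookup (rep p)) (trans (cong (List.lookup (labels Ls)) e) (sym (labelOf≡lookup (rep q)))))))
    h : Fin (classes Ls) → Fin s
    h q = proj₁ (covering (carrier q))
    lookup≡labelOf-rep : ∀ q → List.lookup (labels Ls) q ≡ labelOf (rep (h q))
    lookup≡labelOf-rep q = trans (sym (labelOf-carrier q)) (∼⇒same-label _ _ (proj₂ (covering (carrier q))))
    h-injective : ∀ {p q} → h p ≡ h q → p ≡ q
    h-injective {p} {q} e = lookup-labels-injective p q
      (trans (lookup≡labelOf-rep p) (trans (cong (λ t → labelOf (rep t)) e) (sym (lookup≡labelOf-rep q))))

-- Nested canalising functions are the layered functions

-- A clause (v , α , β) of a decision list: if x v = α then return β.
Clause : ℕ → Set
Clause n = Fin n × Bool × Bool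

input : ∀ {n} → Clause n → Bool
input (_ , α , _) = α

output : ∀ {n} → Clause n → Bool
output (_ , _ , β) = β

decide : ∀ {n} → List (Clause n) → Bool → BoolFun n
decide []                 d x = d
decide ((v , α , β) ∷ cs) d x = if α == x v then β else decide cs d x

decide-match : ∀ {n N} (g : Fin N → Clause n) d x p →
  (∀ q → q Fin.< p → x (proj₁ (g q)) ≡ not (input (g q))) →
  x (proj₁ (g p)) ≡ input (g p) → decide (List.tabulate g) d x ≡ output (g p)
decide-match g d x zero    _      match rewrite match | ==-refl (input (g zero)) = refl
decide-match g d x (suc p) misses match rewrite misses zero (s≤s z≤n) | ==-not (input (g zero)) =
  decide-match (λ k → g (suc k)) d x p (λ q q<p → misses (suc q) (s≤s q<p)) match

decide-default : ∀ {n N} (g : Fin N → Clause n) d x →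
  (∀ q → x (proj₁ (g q)) ≡ not (input (g q))) → decide (List.tabulate g) d x ≡ d
decide-default {N = zero}  g d x misses = refl
decide-default {N = suc N} g d x misses rewrite misses zero | ==-not (input (g zero)) =
  decide-default (λ k → g (suc k)) d x (λ q → misses (suc q))

first-or-none : ∀ {N} (P : Fin N → Set) → (∀ i → Dec (P i)) →
  (∀ i → ¬ P i) ⊎ (∃ λ k → P k × (∀ i → i Fin.< k → ¬ P i))
first-or-none {zero}  P P? = inj₁ λ ()
first-or-none {suc N} P P? with P? zero
... | yes P0 = inj₂ (zero , P0 , λ i ())
... | no ¬P0 with first-or-none (λ i → P (suc i)) (λ i → P? (suc i))
...   | inj₁ none = inj₁ λ { zero → ¬P0 ; (suc i) → none i }
...   | inj₂ (k , Pk , before) = inj₂ (suc k , Pk , λ { zero _ → ¬P0 ; (suc i) (s≤s i<k) → before i i<k })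

lastOutput : ∀ {n} → Clause n → List (Clause n) → Bool
lastOutput c []        = output c
lastOutput _ (c ∷ cs) = lastOutput c cs

lastOutput-tabulate : ∀ {n N} (g : Fin (suc N) → Clause n) →
  lastOutput (g zero) (List.tabulate (λ k → g (suc k))) ≡ output (g (fromℕ N))
lastOutput-tabulate {N = zero}  g = refl
lastOutput-tabulate {N = suc N} g = lastOutput-tabulate (λ k → g (suc k))

ncf-clauses : ∀ {m} {f : BoolFun (suc m)} → IsNCF f → Fin (suc m) → Clause (suc m)
ncf-clauses (σ , a , b , _) k = σ ⟨$⟩ʳ k , a k , b k

ncf⇒decide : ∀ {m} (f : BoolFun (suc m)) (ncf : IsNCF f) →
  ∀ x → f x ≡ decide (List.tabulate (ncf-clauses ncf)) (not (output (ncf-clauses ncf (fromℕ m)))) x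
ncf⇒decide f ncf@(σ , a , b , canalised-at , default) x
  with first-or-none (λ k → x (σ ⟨$⟩ʳ k) ≡ a k) (λ k → x (σ ⟨$⟩ʳ k) Data.Bool.≟ a k)
... | inj₁ none = trans (default x misses) (sym (decide-default (ncf-clauses ncf) _ x misses))
  where
  misses : ∀ i → x (σ ⟨$⟩ʳ i) ≡ not (a i)
  misses i = ¬-not (none i)
... | inj₂ (k , match , before) =
  trans (canalised-at x k misses match) (sym (decide-match (ncf-clauses ncf) _ x k misses match))
  where
  misses : ∀ i → i Fin.< k → x (σ ⟨$⟩ʳ i) ≡ not (a i)
  misses i i<k = ¬-not (before i i<k)

emptyLayer : ∀ {n} → Layer n
emptyLayer {n} = Vec.replicate n nothing

infixl 6 _[_↦_]

_[_↦_] : ∀ {n} → Layer n → Fin n → Bool → Layer n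
L [ v ↦ α ] = L Vec.[ v ]≔ just α

fires-empty : ∀ {n} (x : Fin n → Bool) → fires emptyLayer x ≡ false
fires-empty x = fires-none emptyLayer x λ k c e → case trans (sym (lookup-replicate k nothing)) e of λ ()

fires-extend : ∀ {n} (L : Layer n) v α x → lookup L v ≡ nothing →
  fires (L [ v ↦ α ]) x ≡ (α == x v) ∨ fires L x
fires-extend L v α x Lv = bool-ext to from
  where
  to : fires (L [ v ↦ α ]) x ≡ true → (α == x v) ∨ fires L x ≡ true
  to h with k , e ← fires-elim (L [ v ↦ α ]) x h with k ≟ v
  ... | yes refl rewrite just-injective (trans (sym (lookup∘update k L (just α))) e) | ==-refl (x k) = refl
  ... | no k≢v = trans (cong ((α == x v) ∨_) (fires-intro L x k (x k) (trans (sym (lookup∘update′ k≢v L _)) e) refl))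
                       (∨-zeroʳ (α == x v))
  from : (α == x v) ∨ fires L x ≡ true → fires (L [ v ↦ α ]) x ≡ true
  from h with α == x v in match
  ... | true = fires-intro (L [ v ↦ α ]) x v α (lookup∘update v L (just α)) (sym (==⇒≡ α (x v) match))
  ... | false with k , e ← fires-elim L x h =
    fires-intro (L [ v ↦ α ]) x k (x k) (trans (lookup∘update′ k≢v L _) e) refl
    where
    k≢v : ¬ k ≡ v
    k≢v refl = case trans (sym Lv) e of λ ()

size-extend : ∀ {n} (L : Layer n) v α → lookup L v ≡ nothing → size (L [ v ↦ α ]) ≡ suc (size L)
size-extend (nothing ∷ L) zero    α _ = refl
size-extend (nothing ∷ L) (suc v) α e = size-extend L v α e
size-extend (just _ ∷ L)  (suc v) α e = cong suc (size-extend L v α e)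

∅⊆ : ∀ {n} (R : Vec Bool n) → emptyLayer ⊆ R
∅⊆ R k c e = case trans (sym (lookup-replicate k nothing)) e of λ ()

⊆-extend : ∀ {n} (R : Vec Bool n) L v α → L ⊆ R → L [ v ↦ α ] ⊆ R Vec.[ v ]≔ true
⊆-extend R L v α sub k c e with k ≟ v
... | yes refl = lookup∘update k R true
... | no k≢v = trans (lookup∘update′ k≢v R true) (sub k c (trans (sym (lookup∘update′ k≢v L _)) e))

lookup-∖ : ∀ {n} (R : Vec Bool n) L k → lookup (R ∖ L) k ≡ lookup R k ∧ not (inLayer (lookup L k))
lookup-∖ (r ∷ R) (m ∷ L) zero    = refl
lookup-∖ (r ∷ R) (m ∷ L) (suc k) = lookup-∖ R L k

∖-extend : ∀ {n} (R : Vec Bool n) L v α → lookup R v ≡ false →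
  (R Vec.[ v ]≔ true) ∖ (L [ v ↦ α ]) ≡ R ∖ L
∖-extend R L v α Rv = lookup-ext _ _ λ k →
  trans (lookup-∖ (R Vec.[ v ]≔ true) (L [ v ↦ α ]) k) (trans (pointwise k) (sym (lookup-∖ R L k)))
  where
  pointwise : ∀ k → lookup (R Vec.[ v ]≔ true) k ∧ not (inLayer (lookup (L [ v ↦ α ]) k)) ≡ lookup R k ∧ not (inLayer (lookup L k))
  pointwise k with k ≟ v
  ... | yes refl rewrite lookup∘update k R true | lookup∘update k L (just α) | Rv = refl
  ... | no k≢v rewrite lookup∘update′ k≢v R true | lookup∘update′ k≢v L (just α) = refl

∖-empty : ∀ {n} (R : Vec Bool n) → R ∖ emptyLayer ≡ R
∖-empty []      = refl
∖-empty (r ∷ R) = cong₂ _∷_ (∧-identityʳ r) (∖-empty R)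

variables : ∀ {n} → List (Clause n) → Vec Bool n
variables {n} []       = Vec.replicate n false
variables     (c ∷ cs) = variables cs Vec.[ proj₁ c ]≔ true

Distinct : ∀ {n} → List (Clause n) → Set
Distinct = AllPairs (λ c d → ¬ proj₁ c ≡ proj₁ d)

variables-∉ : ∀ {n} v (cs : List (Clause n)) → All (λ d → ¬ v ≡ proj₁ d) cs → lookup (variables cs) v ≡ false
variables-∉ v []       _           = lookup-replicate v false
variables-∉ v (d ∷ cs) (v≢d ∷ v∉) = trans (lookup∘update′ v≢d (variables cs) true) (variables-∉ v cs v∉)

variables-∈ : ∀ {n} (cs : List (Clause n)) {c} → c ∈ cs → lookup (variables cs) (proj₁ c) ≡ true
variables-∈ (d ∷ cs) (here refl) = lookup∘update (proj₁ d) (variables cs) true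
variables-∈ (d ∷ cs) {c} (there c∈) with proj₁ c ≟ proj₁ d
... | yes e = trans (cong (lookup (variables (d ∷ cs))) e) (lookup∘update (proj₁ d) (variables cs) true)
... | no c≢d = trans (lookup∘update′ c≢d (variables cs) true) (variables-∈ cs c∈)

LayeredForm : ℕ → Set
LayeredForm n = Bool × Layer n × List (Layer n)

Represents : ∀ {n} → Vec Bool n → List (Clause n) → Bool → LayeredForm n → Set
Represents R cs d (b , L , Ls) = Layering R (L ∷ Ls) × (∀ x → decide cs d x ≡ layered b (L ∷ Ls) x)

-- The last variable joins the preceding layer, with its canalising value
-- negated when β₁ ≠ β₂, because x v₂ = not α₂ yields not β₂.
lastPair : ∀ {n} → Clause n → Clause n → LayeredForm n
lastPair (v₁ , α₁ , β₁) (v₂ , α₂ , β₂) =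
  β₁ , emptyLayer [ v₂ ↦ (if β₁ == β₂ then α₂ else not α₂) ] [ v₁ ↦ α₁ ] , []

push : ∀ {n} → Clause n → LayeredForm n → LayeredForm n
push (v , α , β) (b , L , Ls) = if β == b then (β , L [ v ↦ α ] , Ls) else (β , emptyLayer [ v ↦ α ] , L ∷ Ls)

group : ∀ {n} → Clause n → Clause n → List (Clause n) → LayeredForm n
group c₁ c₂ []        = lastPair c₁ c₂
group c₁ c₂ (c₃ ∷ cs) = push c₁ (group c₂ c₃ cs)

size-emptyLayer : ∀ n → size (emptyLayer {n}) ≡ 0
size-emptyLayer zero    = refl
size-emptyLayer (suc n) = size-emptyLayer n

lastPair-agrees : ∀ m₁ β₁ α₂ β₂ y₂ →
  (if m₁ then β₁ else if α₂ == y₂ then β₂ else not β₂) ≡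
  (if m₁ ∨ ((if β₁ == β₂ then α₂ else not α₂) == y₂) ∨ false then β₁ else not β₁)
lastPair-agrees true  _     _     _     _     = refl
lastPair-agrees false true  true  true  true  = refl
lastPair-agrees false true  true  true  false = refl
lastPair-agrees false true  false true  true  = refl
lastPair-agrees false true  false true  false = refl
lastPair-agrees false true  true  false true  = refl
lastPair-agrees false true  true  false false = refl
lastPair-agrees false true  false false true  = refl
lastPair-agrees false true  false false false = refl
lastPair-agrees false false true  true  true  = refl
lastPair-agrees false false true  true  false = refl
lastPair-agrees false false false true  true  = refl
lastPair-agrees false false false true  false = refl
lastPair-agrees false false true  false true  = refl
lastPair-agrees false false true  false false = refl
lastPair-agrees false false false false true  = refl
lastPair-agrees false false false false false = refl

lastPair-correct : ∀ {n} (c₁ c₂ : Clause n) → ¬ proj₁ c₁ ≡ proj₁ c₂ →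
  Represents (variables (c₁ ∷ c₂ ∷ [])) (c₁ ∷ c₂ ∷ []) (not (output c₂)) (lastPair c₁ c₂)
lastPair-correct {n} (v₁ , α₁ , β₁) (v₂ , α₂ , β₂) v₁≢v₂ =
  next (⊆-extend (R₀ Vec.[ v₂ ]≔ true) L₂ v₁ α₁ (⊆-extend R₀ emptyLayer v₂ α₂′ (∅⊆ R₀))) (subst (1 ≤_) (sym two) (s≤s z≤n))
       (λ _ → subst (2 ≤_) (sym two) ≤-refl) (done nothing-left) ,
  agrees
  where
  α₂′ = if β₁ == β₂ then α₂ else not α₂
  R₀ = Vec.replicate n false
  L₂ = emptyLayer [ v₂ ↦ α₂′ ]
  L₂v₁ : lookup L₂ v₁ ≡ nothing
  L₂v₁ = trans (lookup∘update′ v₁≢v₂ emptyLayer _) (lookup-replicate v₁ nothing)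
  two : size (L₂ [ v₁ ↦ α₁ ]) ≡ 2
  two = trans (size-extend L₂ v₁ α₁ L₂v₁)
              (cong suc (trans (size-extend emptyLayer v₂ α₂′ (lookup-replicate v₂ nothing)) (cong suc (size-emptyLayer n))))
  nothing-left : ∀ k → lookup (variables ((v₁ , α₁ , β₁) ∷ (v₂ , α₂ , β₂) ∷ []) ∖ (L₂ [ v₁ ↦ α₁ ])) k ≡ false
  nothing-left k rewrite ∖-extend (R₀ Vec.[ v₂ ]≔ true) L₂ v₁ α₁ (trans (lookup∘update′ v₁≢v₂ R₀ true) (lookup-replicate v₁ false))
                       | ∖-extend R₀ emptyLayer v₂ α₂′ (lookup-replicate v₂ false) | ∖-empty R₀ = lookup-replicate k false
  agrees : ∀ x → decide ((v₁ , α₁ , β₁) ∷ (v₂ , α₂ , β₂) ∷ []) (not β₂) x ≡ layered β₁ (L₂ [ v₁ ↦ α₁ ] ∷ []) x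
  agrees x rewrite fires-extend L₂ v₁ α₁ x L₂v₁ | fires-extend emptyLayer v₂ α₂′ x (lookup-replicate v₂ nothing)
                 | fires-empty x = lastPair-agrees (α₁ == x v₁) β₁ α₂ β₂ (x v₂)

push-correct : ∀ {n} {R : Vec Bool n} {cs d} (c : Clause n) form → Represents R cs d form →
  lookup R (proj₁ c) ≡ false → Represents (R Vec.[ proj₁ c ]≔ true) (c ∷ cs) d (push c form)
push-correct {n} {R} {cs} {d} (v , α , β) (b , L , Ls) (V@(next sub nonempty _ tail) , agrees) Rv
  with β == b in same
... | true = next (⊆-extend R L v α sub) (subst (1 ≤_) (sym grown) (s≤s z≤n)) (λ _ → subst (2 ≤_) (sym grown) (s≤s nonempty))
               (subst (λ Q → Layering Q Ls) (sym (∖-extend R L v α Rv)) tail) ,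
             merged
  where
  Lv : lookup L v ≡ nothing
  Lv = ⊆-outside R L sub v Rv
  grown : size (L [ v ↦ α ]) ≡ suc (size L)
  grown = size-extend L v α Lv
  merged : ∀ x → decide ((v , α , β) ∷ cs) d x ≡ layered β (L [ v ↦ α ] ∷ Ls) x
  merged x rewrite fires-extend L v α x Lv | agrees x | ==⇒≡ β b same with α == x v
  ... | true  = refl
  ... | false = refl
... | false = next (⊆-extend R emptyLayer v α (∅⊆ R)) (subst (1 ≤_) (sym single) (s≤s z≤n)) (λ ())
                   (subst (λ Q → Layering Q (L ∷ Ls)) (sym (trans (∖-extend R emptyLayer v α Rv) (∖-empty R))) V) ,
              separate
  where
  single : size (emptyLayer [ v ↦ α ]) ≡ 1
  single = trans (size-extend emptyLayer v α (lookup-replicate v nothing)) (cong suc (size-emptyLayer n))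
  separate : ∀ x → decide ((v , α , β) ∷ cs) d x ≡ layered β (emptyLayer [ v ↦ α ] ∷ L ∷ Ls) x
  separate x rewrite fires-extend emptyLayer v α x (lookup-replicate v nothing) | fires-empty x | agrees x
                   | ==-false⇒≡not β b same with α == x v
  ... | true  = refl
  ... | false = refl

group-correct : ∀ {n} (c₁ c₂ : Clause n) cs → Distinct (c₁ ∷ c₂ ∷ cs) →
  Represents (variables (c₁ ∷ c₂ ∷ cs)) (c₁ ∷ c₂ ∷ cs) (not (lastOutput c₂ cs)) (group c₁ c₂ cs)
group-correct c₁ c₂ []        ((c₁≢c₂ ∷ []) ∷ _) = lastPair-correct c₁ c₂ c₁≢c₂
group-correct c₁ c₂ (c₃ ∷ cs) (c₁∉ ∷ distinct) =
  push-correct {R = variables (c₂ ∷ c₃ ∷ cs)} {c₂ ∷ c₃ ∷ cs} {not (lastOutput c₃ cs)} c₁ (group c₂ c₃ cs)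
    (group-correct c₂ c₃ cs distinct) (variables-∉ (proj₁ c₁) (c₂ ∷ c₃ ∷ cs) c₁∉)

full : ∀ n → Vec Bool n
full n = Vec.replicate n true

ncf⇒layered : ∀ {m} (f : BoolFun (suc (suc m))) → IsNCF f →
  ∃₂ λ b Ls → Layering (full (suc (suc m))) Ls × (∀ x → f x ≡ layered b Ls x)
ncf⇒layered {m} f ncf@(σ , _) =
  proj₁ form , L ∷ Ls , subst (λ R → Layering R (L ∷ Ls)) all-variables (proj₁ correct) ,
  λ x → trans (ncf⇒decide f ncf x) (trans (cong (λ d → decide cs d x) default-output) (proj₂ correct x))
  where
  g = ncf-clauses ncf
  cs = List.tabulate g
  rest = List.tabulate (λ k → g (suc (suc k)))
  form = group (g zero) (g (suc zero)) rest
  L = proj₁ (proj₂ form)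
  Ls = proj₂ (proj₂ form)
  distinct : Distinct cs
  distinct = AllPairsₚ.tabulate⁺ {f = g} λ {i} {j} i≢j e → i≢j (trans (sym (inverseˡ σ)) (trans (cong (σ ⟨$⟩ˡ_) e) (inverseˡ σ)))
  correct = group-correct (g zero) (g (suc zero)) rest distinct
  default-output : not (output (g (fromℕ (suc m)))) ≡ not (lastOutput (g (suc zero)) rest)
  default-output = cong not (sym (lastOutput-tabulate (λ k → g (suc k))))
  all-variables : variables cs ≡ full (suc (suc m))
  all-variables = lookup-ext _ _ λ k →
    trans (subst (λ v → lookup (variables cs) v ≡ true) (inverseʳ σ) (variables-∈ cs (∈-tabulate⁺ {f = g} (σ ⟨$⟩ˡ k))))
          (sym (lookup-replicate k true))

shiftClause : ∀ {n} → Clause n → Clause (suc n)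
shiftClause (v , α , β) = suc v , α , β

layerClauses : ∀ {n} → Layer n → Bool → List (Clause n)
layerClauses []            β = []
layerClauses (nothing ∷ L) β = List.map shiftClause (layerClauses L β)
layerClauses (just α ∷ L)  β = (zero , α , β) ∷ List.map shiftClause (layerClauses L β)

matches : ∀ {n} → List (Clause n) → (Fin n → Bool) → Bool
matches []                 x = false
matches ((v , α , β) ∷ cs) x = (α == x v) ∨ matches cs x

matches-shift : ∀ {n} (cs : List (Clause n)) x → matches (List.map shiftClause cs) x ≡ matches cs (λ k → x (suc k))
matches-shift []                 x = refl
matches-shift ((v , α , β) ∷ cs) x = cong ((α == x (suc v)) ∨_) (matches-shift cs x)

matches-layerClauses : ∀ {n} (L : Layer n) β x → matches (layerClauses L β) x ≡ fires L x
matches-layerClauses []            β x = refl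
matches-layerClauses (nothing ∷ L) β x =
  trans (matches-shift (layerClauses L β) x) (matches-layerClauses L β (λ k → x (suc k)))
matches-layerClauses (just α ∷ L)  β x =
  cong ((α == x zero) ∨_) (trans (matches-shift (layerClauses L β) x) (matches-layerClauses L β (λ k → x (suc k))))

layerClauses-output : ∀ {n} (L : Layer n) β → All (λ c → output c ≡ β) (layerClauses L β)
layerClauses-output []            β = []
layerClauses-output (nothing ∷ L) β = Allₚ.map⁺ (layerClauses-output L β)
layerClauses-output (just α ∷ L)  β = refl ∷ Allₚ.map⁺ (layerClauses-output L β)

decide-++ : ∀ {n} (cs : List (Clause n)) β ds d x → All (λ c → output c ≡ β) cs →
  decide (cs ++ ds) d x ≡ (if matches cs x then β else decide ds d x)
decide-++ []                 β ds d x _            = refl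
decide-++ ((v , α , _) ∷ cs) β ds d x (refl ∷ outs) with α == x v
... | true  = refl
... | false = decide-++ cs β ds d x outs

finalValue : ∀ {n} → Bool → List (Layer n) → Bool
finalValue b []       = b
finalValue b (L ∷ Ls) = finalValue (not b) Ls

flatten : ∀ {n} → Bool → List (Layer n) → List (Clause n)
flatten b []       = []
flatten b (L ∷ Ls) = layerClauses L b ++ flatten (not b) Ls

decide-flatten : ∀ {n} b (Ls : List (Layer n)) x → decide (flatten b Ls) (finalValue b Ls) x ≡ layered b Ls x
decide-flatten b []       x = refl
decide-flatten b (L ∷ Ls) x = trans (decide-++ (layerClauses L b) b (flatten (not b) Ls) _ x (layerClauses-output L b))
  (cong₂ (λ c r → if c then b else r) (matches-layerClauses L b x) (decide-flatten (not b) Ls x))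

layerClauses-∈ : ∀ {n} (L : Layer n) β {c} → c ∈ layerClauses L β → lookup L (proj₁ c) ≡ just (proj₁ (proj₂ c))
layerClauses-∈ (nothing ∷ L) β c∈ with _ , c′∈ , refl ← ∈-map⁻ shiftClause c∈ = layerClauses-∈ L β c′∈
layerClauses-∈ (just α ∷ L)  β (here refl) = refl
layerClauses-∈ (just α ∷ L)  β (there c∈) with _ , c′∈ , refl ← ∈-map⁻ shiftClause c∈ = layerClauses-∈ L β c′∈

layerClauses-complete : ∀ {n} (L : Layer n) β k α → lookup L k ≡ just α → (k , α , β) ∈ layerClauses L β
layerClauses-complete (nothing ∷ L) β (suc k) α e = ∈-map⁺ shiftClause (layerClauses-complete L β k α e)
layerClauses-complete (just _ ∷ L)  β zero    α refl = here refl
layerClauses-complete (just _ ∷ L)  β (suc k) α e = there (∈-map⁺ shiftClause (layerClauses-complete L β k α e))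

length-layerClauses : ∀ {n} (L : Layer n) β → length (layerClauses L β) ≡ size L
length-layerClauses []            β = refl
length-layerClauses (nothing ∷ L) β = trans (length-map shiftClause (layerClauses L β)) (length-layerClauses L β)
length-layerClauses (just _ ∷ L)  β = cong suc (trans (length-map shiftClause (layerClauses L β)) (length-layerClauses L β))

layerClauses-distinct : ∀ {n} (L : Layer n) β → Distinct (layerClauses L β)
layerClauses-distinct []            β = []
layerClauses-distinct (nothing ∷ L) β = shift-distinct (layerClauses-distinct L β)
  where
  shift-distinct : ∀ {n} {cs : List (Clause n)} → Distinct cs → Distinct (List.map shiftClause cs)
  shift-distinct = AllPairsₚ.map⁺ ∘ AllPairs.map (λ v≢w e → v≢w (suc-injective e))
layerClauses-distinct (just _ ∷ L)  β =
  All.tabulate (λ c∈ → zero≢ c∈) ∷ AllPairsₚ.map⁺ (AllPairs.map (λ v≢w e → v≢w (suc-injective e)) (layerClauses-distinct L β))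
  where
  zero≢ : ∀ {c} → c ∈ List.map shiftClause (layerClauses L β) → ¬ zero ≡ proj₁ c
  zero≢ c∈ with _ , _ , refl ← ∈-map⁻ shiftClause c∈ = λ ()

sizes : ∀ {n} (Ls : List (Layer n)) → Vec ℕ (length Ls)
sizes []       = []
sizes (L ∷ Ls) = size L ∷ sizes Ls

length-flatten : ∀ {n} b (Ls : List (Layer n)) → length (flatten b Ls) ≡ vsum (sizes Ls)
length-flatten b []       = refl
length-flatten b (L ∷ Ls) = trans (length-++ (layerClauses L b)) (cong₂ _+_ (length-layerClauses L b) (length-flatten (not b) Ls))

flatten-⊆ : ∀ {n} {R : Vec Bool n} {Ls} → Layering R Ls → ∀ b {c} → c ∈ flatten b Ls → lookup R (proj₁ c) ≡ true
flatten-⊆ {R = R} (next {L = L} sub _ _ tail) b {c} c∈ with ∈-++⁻ (layerClauses L b) c∈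
... | inj₁ c∈L  = sub (proj₁ c) _ (layerClauses-∈ L b c∈L)
... | inj₂ c∈Ls = proj₁ (∖-true⁻ R L _ (flatten-⊆ tail (not b) c∈Ls))

flatten-complete : ∀ {n} {R : Vec Bool n} {Ls} → Layering R Ls → ∀ b k → lookup R k ≡ true →
  ∃ λ c → c ∈ flatten b Ls × proj₁ c ≡ k
flatten-complete (done outside) b k Rk with () ← trans (sym Rk) (outside k)
flatten-complete {R = R} (next {L = L} _ _ _ tail) b k Rk with lookup L k in Lk
... | just α  = (k , α , b) , ∈-++⁺ˡ (layerClauses-complete L b k α Lk) , refl
... | nothing with c , c∈ , refl ← flatten-complete tail (not b) k (∖-keeps R L k Rk Lk) =
  c , ∈-++⁺ʳ (layerClauses L b) c∈ , refl

flatten-distinct : ∀ {n} {R : Vec Bool n} {Ls} → Layering R Ls → ∀ b → Distinct (flatten b Ls)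
flatten-distinct (done _) b = []
flatten-distinct {R = R} (next {L = L} {Ls} _ _ _ tail) b =
  AllPairsₚ.++⁺ (layerClauses-distinct L b) (flatten-distinct tail (not b))
    (All.tabulate λ c∈ → All.tabulate λ d∈ → apart c∈ d∈)
  where
  apart : ∀ {c d} → c ∈ layerClauses L b → d ∈ flatten (not b) Ls → ¬ proj₁ c ≡ proj₁ d
  apart c∈ d∈ e with () ← trans (sym (layerClauses-∈ L b c∈))
                           (proj₂ (∖-true⁻ R L _ (trans (cong (lookup (R ∖ L)) e) (flatten-⊆ tail (not b) d∈))))

lastOutputOf : ∀ {n} → List (Clause n) → Bool
lastOutputOf []       = false
lastOutputOf (c ∷ cs) = lastOutput c cs

lastOutputOf-++ : ∀ {n} (cs ds : List (Clause n)) → ¬ ds ≡ [] → lastOutputOf (cs ++ ds) ≡ lastOutputOf ds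
lastOutputOf-++ []            ds       ds≢[] = refl
lastOutputOf-++ (c ∷ [])      []       ds≢[] = ⊥-elim (ds≢[] refl)
lastOutputOf-++ (c ∷ [])      (d ∷ ds) ds≢[] = refl
lastOutputOf-++ (c ∷ c′ ∷ cs) ds       ds≢[] = lastOutputOf-++ (c′ ∷ cs) ds ds≢[]

lastOutputOf-all : ∀ {n} (cs : List (Clause n)) β → All (λ c → output c ≡ β) cs → ¬ cs ≡ [] → lastOutputOf cs ≡ β
lastOutputOf-all []            β _               cs≢[] = ⊥-elim (cs≢[] refl)
lastOutputOf-all (c ∷ [])      β (out ∷ [])      _     = out
lastOutputOf-all (c ∷ c′ ∷ cs) β (_ ∷ outs)      _     = lastOutputOf-all (c′ ∷ cs) β outs (λ ())

layerClauses-nonempty : ∀ {n} (L : Layer n) β → 1 ≤ size L → ¬ layerClauses L β ≡ []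
layerClauses-nonempty L β nonempty e with () ← subst (1 ≤_) (trans (sym (length-layerClauses L β)) (cong length e)) nonempty

flatten-last : ∀ {n} {R : Vec Bool n} {L Ls} → Layering R (L ∷ Ls) → ∀ b →
  lastOutputOf (flatten b (L ∷ Ls)) ≡ not (finalValue b (L ∷ Ls))
flatten-last {L = L} {[]} (next _ nonempty _ _) b =
  trans (cong lastOutputOf (++-identityʳ (layerClauses L b)))
        (trans (lastOutputOf-all (layerClauses L b) b (layerClauses-output L b) (layerClauses-nonempty L b nonempty))
               (sym (not-involutive b)))
flatten-last {L = L} {L′ ∷ Ls} (next _ _ _ tail@(next _ nonempty′ _ _)) b =
  trans (lastOutputOf-++ (layerClauses L b) _ later-nonempty) (flatten-last tail (not b))
  where
  later-nonempty : ¬ flatten (not b) (L′ ∷ Ls) ≡ []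
  later-nonempty e = layerClauses-nonempty L′ (not b) nonempty′ (++-conicalˡ (layerClauses L′ (not b)) _ e)

card : ∀ {n} → Vec Bool n → ℕ
card []          = 0
card (true ∷ R)  = suc (card R)
card (false ∷ R) = card R

card-full : ∀ n → card (full n) ≡ n
card-full zero    = refl
card-full (suc n) = cong suc (card-full n)

card-∖ : ∀ {n} (R : Vec Bool n) L → L ⊆ R → card (R ∖ L) + size L ≡ card R
card-∖ []          []            sub = refl
card-∖ (true ∷ R)  (nothing ∷ L) sub = cong suc (card-∖ R L (λ k → sub (suc k)))
card-∖ (true ∷ R)  (just c ∷ L)  sub = trans (+-suc _ _) (cong suc (card-∖ R L (λ k → sub (suc k))))
card-∖ (false ∷ R) (nothing ∷ L) sub = card-∖ R L (λ k → sub (suc k))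
card-∖ (false ∷ R) (just c ∷ L)  sub with () ← sub zero c refl

card-empty : ∀ {n} (R : Vec Bool n) → (∀ k → lookup R k ≡ false) → card R ≡ 0
card-empty []          _       = refl
card-empty (false ∷ R) outside = card-empty R (λ k → outside (suc k))
card-empty (true ∷ R)  outside with () ← outside zero

card-zero : ∀ {n} (R : Vec Bool n) → card R ≡ 0 → ∀ k → lookup R k ≡ false
card-zero (false ∷ R) e zero    = refl
card-zero (false ∷ R) e (suc k) = card-zero R e k

sum-sizes : ∀ {n} {R : Vec Bool n} {Ls} → Layering R Ls → vsum (sizes Ls) ≡ card R
sum-sizes {R = R} (done outside) = sym (card-empty R outside)
sum-sizes {R = R} (next {L = L} sub _ _ tail) =
  trans (cong (size L +_) (sum-sizes tail)) (trans (+-comm (size L) _) (card-∖ R L sub))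

tabulate-lookup-cast : ∀ {A : Set} (xs : List A) {N} (eq : N ≡ length xs) →
  List.tabulate (λ k → List.lookup xs (Fin.cast eq k)) ≡ xs
tabulate-lookup-cast xs refl = trans (List.tabulate-cong (λ k → cong (List.lookup xs) (cast-is-id refl k))) (tabulate-lookup xs)

layered⇒ncf : ∀ {m} b (Ls : List (Layer (suc m))) → Layering (full (suc m)) Ls → IsNCF (layered b Ls)
layered⇒ncf {m} b [] (done outside) = ⊥-elim (case trans (sym (lookup-replicate {n = suc m} zero true)) (outside zero) of λ ())
layered⇒ncf {m} b Ls@(_ ∷ _) V = σ , input ∘ clause , output ∘ clause , canalised-at , default
  where
  cs = flatten b Ls
  final = finalValue b Ls
  m+1≡length : suc m ≡ length cs
  m+1≡length = sym (trans (length-flatten b Ls) (trans (sum-sizes V) (card-full (suc m))))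
  clause : Fin (suc m) → Clause (suc m)
  clause k = List.lookup cs (Fin.cast m+1≡length k)
  var : Fin (suc m) → Fin (suc m)
  var k = proj₁ (clause k)
  var-injective : ∀ p q → var p ≡ var q → p ≡ q
  var-injective p q e = begin
    p                                                        ≡⟨ sym (cast-involutive (sym m+1≡length) m+1≡length p) ⟩
    Fin.cast (sym m+1≡length) (Fin.cast m+1≡length p)       ≡⟨ cong (Fin.cast _) (lookup-injective proj₁ (flatten-distinct V b) _ _ e) ⟩
    Fin.cast (sym m+1≡length) (Fin.cast m+1≡length q)       ≡⟨ cast-involutive (sym m+1≡length) m+1≡length q ⟩
    q                                                        ∎
    where open ≡-Reasoning
  position : ∀ i → ∃ λ k → var k ≡ i
  position i with c , c∈ , refl ← flatten-complete V b i (lookup-replicate i true) =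
    Fin.cast (sym m+1≡length) (Any.index c∈) ,
    trans (cong (λ j → proj₁ (List.lookup cs j)) (cast-involutive m+1≡length (sym m+1≡length) (Any.index c∈)))
          (cong proj₁ (sym (lookup-index c∈)))
  σ : Permutation′ (suc m)
  σ = permutation var (λ i → proj₁ (position i)) (λ i → proj₂ (position i)) (λ k → var-injective _ _ (proj₂ (position (var k))))
  clauses≡cs : List.tabulate clause ≡ cs
  clauses≡cs = tabulate-lookup-cast cs m+1≡length
  as-decision : ∀ x → layered b Ls x ≡ decide (List.tabulate clause) final x
  as-decision x = trans (sym (decide-flatten b Ls x)) (cong (λ cs → decide cs final x) (sym clauses≡cs))
  canalised-at : ∀ x (k : Fin (suc m)) → (∀ i → i Fin.< k → x (σ ⟨$⟩ʳ i) ≡ not (input (clause i))) →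
                 x (σ ⟨$⟩ʳ k) ≡ input (clause k) → layered b Ls x ≡ output (clause k)
  canalised-at x k misses match = trans (as-decision x) (decide-match clause final x k misses match)
  last-out : output (clause (fromℕ m)) ≡ not final
  last-out = trans (sym (lastOutput-tabulate clause)) (trans (cong lastOutputOf clauses≡cs) (flatten-last V b))
  default : ∀ x → (∀ i → x (σ ⟨$⟩ʳ i) ≡ not (input (clause i))) → layered b Ls x ≡ not (output (clause (fromℕ m)))
  default x misses = trans (as-decision x)
    (trans (decide-default clause final x misses) (sym (trans (cong not last-out) (not-involutive final))))

-- Counting layers and layerings

when : ∀ {A : Set} → Bool → List A → List A
when true  xs = xs
when false xs = []

layersWith : ∀ {n} → Vec Bool n → ℕ → Bool → Bool → List (Layer n)
layersWith []          zero    false false = [] ∷ []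
layersWith []          _       _     _     = []
layersWith (false ∷ R) k       p     q     = List.map (nothing ∷_) (layersWith R k p q)
layersWith (true ∷ R)  zero    p     q     = List.map (nothing ∷_) (layersWith R zero p q)
layersWith (true ∷ R)  (suc k) p     q     =
  List.map (nothing ∷_) (layersWith R (suc k) p q) ++
  List.map (just true ∷_) (when p (layersWith R k true q ++ layersWith R k false q)) ++
  List.map (just false ∷_) (when q (layersWith R k p true ++ layersWith R k p false))

record Shape {n} (R : Vec Bool n) (k : ℕ) (p q : Bool) (L : Layer n) : Set where
  constructor shape
  field
    within : L ⊆ R
    size≡  : size L ≡ k
    true∈  : hasValue L true ≡ p
    false∈ : hasValue L false ≡ q

shape-nothing : ∀ {n} {R : Vec Bool n} {k p q L} r → Shape R k p q L → Shape (r ∷ R) k p q (nothing ∷ L)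
shape-nothing r (shape within size≡ true∈ false∈) = shape (λ { (suc j) → within j }) size≡ true∈ false∈

shape-true : ∀ {n} {R : Vec Bool n} {k p q L} → Shape R k p q L → Shape (true ∷ R) (suc k) true q (just true ∷ L)
shape-true (shape within size≡ _ false∈) = shape (λ { zero _ _ → refl ; (suc j) → within j }) (cong suc size≡) refl false∈

shape-false : ∀ {n} {R : Vec Bool n} {k p q L} → Shape R k p q L → Shape (true ∷ R) (suc k) p true (just false ∷ L)
shape-false (shape within size≡ true∈ _) = shape (λ { zero _ _ → refl ; (suc j) → within j }) (cong suc size≡) true∈ refl

∈-when⁻ : ∀ {A : Set} b {x : A} xs → x ∈ when b xs → b ≡ true × x ∈ xs
∈-when⁻ true xs x∈ = refl , x∈

∈-choose : ∀ {A : Set} {x : A} (f : Bool → List A) b → x ∈ f b → x ∈ f true ++ f false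
∈-choose f true  x∈ = ∈-++⁺ˡ x∈
∈-choose f false x∈ = ∈-++⁺ʳ (f true) x∈

layersWith-shape : ∀ {n} (R : Vec Bool n) k p q {L} → L ∈ layersWith R k p q → Shape R k p q L
layersWith-shape []          zero    false false (here refl) = shape (λ ()) refl refl refl
layersWith-shape []          zero    false true  ()
layersWith-shape []          zero    true  _     ()
layersWith-shape []          (suc k) _     _     ()
layersWith-shape (false ∷ R) k       p     q     L∈ with _ , L∈′ , refl ← ∈-map⁻ (nothing ∷_) L∈ =
  shape-nothing false (layersWith-shape R k p q L∈′)
layersWith-shape (true ∷ R)  zero    p     q     L∈ with _ , L∈′ , refl ← ∈-map⁻ (nothing ∷_) L∈ =
  shape-nothing true (layersWith-shape R zero p q L∈′)
layersWith-shape (true ∷ R)  (suc k) p     q     L∈ with ∈-++⁻ (List.map (nothing ∷_) (layersWith R (suc k) p q)) L∈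
... | inj₁ L∈A with _ , L∈′ , refl ← ∈-map⁻ (nothing ∷_) L∈A = shape-nothing true (layersWith-shape R (suc k) p q L∈′)
... | inj₂ L∈BC with ∈-++⁻ (List.map (just true ∷_) (when p (layersWith R k true q ++ layersWith R k false q))) L∈BC
...   | inj₁ L∈B with _ , L∈′ , refl ← ∈-map⁻ (just true ∷_) L∈B
                 with refl , L∈″ ← ∈-when⁻ p _ L∈′ with ∈-++⁻ (layersWith R k true q) L∈″
...     | inj₁ L∈T = shape-true (layersWith-shape R k true q L∈T)
...     | inj₂ L∈F = shape-true (layersWith-shape R k false q L∈F)
layersWith-shape (true ∷ R)  (suc k) p q L∈ | inj₂ L∈BC | inj₂ L∈C
  with _ , L∈′ , refl ← ∈-map⁻ (just false ∷_) L∈C with refl , L∈″ ← ∈-when⁻ q _ L∈′ with ∈-++⁻ (layersWith R k p true) L∈″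
... | inj₁ L∈T = shape-false (layersWith-shape R k p true L∈T)
... | inj₂ L∈F = shape-false (layersWith-shape R k p false L∈F)

∈-layersWith-nothing : ∀ {n} (R : Vec Bool n) k p q {L} → L ∈ layersWith R k p q →
  nothing ∷ L ∈ layersWith (true ∷ R) k p q
∈-layersWith-nothing R zero    p q L∈ = ∈-map⁺ (nothing ∷_) L∈
∈-layersWith-nothing R (suc k) p q L∈ = ∈-++⁺ˡ (∈-map⁺ (nothing ∷_) L∈)

layersWith-complete : ∀ {n} (R : Vec Bool n) L → L ⊆ R →
  L ∈ layersWith R (size L) (hasValue L true) (hasValue L false)
layersWith-complete []          []            _   = here refl
layersWith-complete (false ∷ R) (nothing ∷ L) sub = ∈-map⁺ (nothing ∷_) (layersWith-complete R L (λ k → sub (suc k)))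
layersWith-complete (false ∷ R) (just c ∷ L)  sub with () ← sub zero c refl
layersWith-complete (true ∷ R)  (nothing ∷ L) sub =
  ∈-layersWith-nothing R (size L) _ _ (layersWith-complete R L (λ k → sub (suc k)))
layersWith-complete (true ∷ R)  (just true ∷ L) sub =
  ∈-++⁺ʳ (List.map (nothing ∷_) (layersWith R (suc (size L)) true _)) (∈-++⁺ˡ (∈-map⁺ (just true ∷_)
    (∈-choose (λ p → layersWith R (size L) p (hasValue L false)) _ (layersWith-complete R L (λ k → sub (suc k))))))
layersWith-complete (true ∷ R)  (just false ∷ L) sub =
  ∈-++⁺ʳ (List.map (nothing ∷_) (layersWith R (suc (size L)) _ true)) (∈-++⁺ʳ (List.map (just true ∷_) _) (∈-map⁺ (just false ∷_)
    (∈-choose (λ q → layersWith R (size L) (hasValue L true) q) _ (layersWith-complete R L (λ k → sub (suc k))))))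

map-∷-disjoint : ∀ {A : Set} {n} {a b : A} {xs ys : List (Vec A n)} → ¬ a ≡ b →
  ∀ {v} → ¬ (v ∈ List.map (a ∷_) xs × v ∈ List.map (b ∷_) ys)
map-∷-disjoint a≢b (v∈ , v∈′) with _ , _ , refl ← ∈-map⁻ _ v∈ | _ , _ , e ← ∈-map⁻ _ v∈′ = a≢b (∷-injectiveˡ e)

layersWith-unique : ∀ {n} (R : Vec Bool n) k p q → Unique (layersWith R k p q)
layersWith-unique []          zero    false false = [] ∷ []
layersWith-unique []          zero    false true  = []
layersWith-unique []          zero    true  _     = []
layersWith-unique []          (suc k) _     _     = []
layersWith-unique (false ∷ R) k       p     q     = Unique.map⁺ ∷-injectiveʳ (layersWith-unique R k p q)
layersWith-unique (true ∷ R)  zero    p     q     = Unique.map⁺ ∷-injectiveʳ (layersWith-unique R zero p q)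
layersWith-unique (true ∷ R)  (suc k) p     q     =
  Unique.++⁺ (Unique.map⁺ ∷-injectiveʳ (layersWith-unique R (suc k) p q))
    (Unique.++⁺ (Unique.map⁺ ∷-injectiveʳ (when-unique p (Unique.++⁺ (layersWith-unique R k true q) (layersWith-unique R k false q) true-apart)))
                (Unique.map⁺ ∷-injectiveʳ (when-unique q (Unique.++⁺ (layersWith-unique R k p true) (layersWith-unique R k p false) false-apart)))
                (map-∷-disjoint {xs = Bs} {Cs} (λ ())))
    nothing-apart
  where
  As = layersWith R (suc k) p q
  Bs = when p (layersWith R k true q ++ layersWith R k false q)
  Cs = when q (layersWith R k p true ++ layersWith R k p false)
  nothing-apart : ∀ {L} → ¬ (L ∈ List.map (nothing ∷_) As × L ∈ List.map (just true ∷_) Bs ++ List.map (just false ∷_) Cs)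
  nothing-apart (L∈A , L∈BC) with ∈-++⁻ (List.map (just true ∷_) Bs) L∈BC
  ... | inj₁ L∈B = map-∷-disjoint {xs = As} {Bs} (λ ()) (L∈A , L∈B)
  ... | inj₂ L∈C = map-∷-disjoint {xs = As} {Cs} (λ ()) (L∈A , L∈C)
  when-unique : ∀ {A : Set} b {xs : List A} → Unique xs → Unique (when b xs)
  when-unique true  u = u
  when-unique false u = []
  true-apart : ∀ {L} → ¬ (L ∈ layersWith R k true q × L ∈ layersWith R k false q)
  true-apart (L∈T , L∈F)
    with () ← trans (sym (Shape.true∈ (layersWith-shape R k true q L∈T))) (Shape.true∈ (layersWith-shape R k false q L∈F))
  false-apart : ∀ {L} → ¬ (L ∈ layersWith R k p true × L ∈ layersWith R k p false)
  false-apart (L∈T , L∈F)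
    with () ← trans (sym (Shape.false∈ (layersWith-shape R k p true L∈T))) (Shape.false∈ (layersWith-shape R k p false L∈F))

-- 2ᵏ − 2 counts the layers on k given variables using both canalising values.
infixl 7 _choose_

opaque
  _choose_ : ℕ → ℕ → ℕ
  _choose_ = _C_

  choose-zero : ∀ m → m choose 0 ≡ 1
  choose-zero m = trans (nCk≡nC[n∸k] {0} {m} z≤n) (nCn≡1 m)

  choose-pascal : ∀ m k → m choose k + m choose suc k ≡ suc m choose suc k
  choose-pascal = nCk+nC[k+1]≡[n+1]C[k+1]

  empty-choose : ∀ k → 0 choose suc k ≡ 0
  empty-choose k = refl

  choose-factorial : ∀ m k → k ≤ m → m choose k * (k ! * (m ∸ k) !) ≡ m !
  choose-factorial m k k≤m = trans (cong (_* (k ! * (m ∸ k) !)) (nCk≡n!/k![n-k]! k≤m)) (m/n*n≡m (k![n∸k]!∣n! k≤m))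
    where
    instance
      k![m∸k]!≢0 : ℕ.NonZero (k ! * (m ∸ k) !)
      k![m∸k]!≢0 = m*n≢0 (k !) ((m ∸ k) !) {{k !≢0}} {{(m ∸ k) !≢0}}

bothValues : ℕ → ℕ
bothValues k = 2 ^ k ∸ 2

shapeCount : ℕ → ℕ → Bool → Bool → ℕ
shapeCount m zero    false false = 1
shapeCount m zero    _     _     = 0
shapeCount m (suc k) false false = 0
shapeCount m (suc k) true  false = m choose suc k
shapeCount m (suc k) false true  = m choose suc k
shapeCount m (suc k) true  true  = m choose suc k * bothValues (suc k)

count-if : Bool → ℕ → ℕ
count-if b c = if b then c else 0

length-when : ∀ {A : Set} b (xs : List A) → length (when b xs) ≡ count-if b (length xs)
length-when true  xs = refl
length-when false xs = refl

2≤2^suc : ∀ k → 2 ≤ 2 ^ suc k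
2≤2^suc k = *-monoʳ-≤ 2 (m^n>0 2 k)

bothValues-suc : ∀ k → bothValues (suc (suc k)) ≡ 2 * (bothValues (suc k) + 1)
bothValues-suc k = begin
  2 * 2 ^ suc k ∸ 2            ≡⟨ cong (λ e → 2 * e ∸ 2) (sym (m∸n+n≡m (2≤2^suc k))) ⟩
  2 * (2 ^ suc k ∸ 2 + 2) ∸ 2  ≡⟨ cong (_∸ 2) (*-distribˡ-+ 2 (2 ^ suc k ∸ 2) 2) ⟩
  2 * (2 ^ suc k ∸ 2) + 4 ∸ 2  ≡⟨ +-∸-assoc (2 * (2 ^ suc k ∸ 2)) {4} {2} (s≤s (s≤s z≤n)) ⟩
  2 * (2 ^ suc k ∸ 2) + 2      ≡⟨ sym (*-distribˡ-+ 2 (2 ^ suc k ∸ 2) 1) ⟩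
  2 * (2 ^ suc k ∸ 2 + 1)      ∎
  where open ≡-Reasoning

shapeCount-zero : ∀ m m′ p q → shapeCount m zero p q ≡ shapeCount m′ zero p q
shapeCount-zero m m′ false false = refl
shapeCount-zero m m′ false true  = refl
shapeCount-zero m m′ true  _     = refl

shapeCount-suc : ∀ m k p q →
  shapeCount m (suc k) p q + (count-if p (shapeCount m k true q + shapeCount m k false q) +
                              count-if q (shapeCount m k p true + shapeCount m k p false))
  ≡ shapeCount (suc m) (suc k) p q
shapeCount-suc m k       false false = refl
shapeCount-suc m zero    true  false = trans (cong (m choose 1 +_) (sym (choose-zero m))) (trans (+-comm (m choose 1) _) (choose-pascal m 0))
shapeCount-suc m (suc k) true  false =
  trans (cong (m choose suc (suc k) +_) (trans (+-identityʳ _) (+-identityʳ _)))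
        (trans (+-comm (m choose suc (suc k)) _) (choose-pascal m (suc k)))
shapeCount-suc m zero    false true  = trans (cong (m choose 1 +_) (sym (choose-zero m))) (trans (+-comm (m choose 1) _) (choose-pascal m 0))
shapeCount-suc m (suc k) false true  =
  trans (cong (m choose suc (suc k) +_) (+-identityʳ _)) (trans (+-comm (m choose suc (suc k)) _) (choose-pascal m (suc k)))
shapeCount-suc m zero    true  true  = trans (+-identityʳ (m choose 1 * 0)) (trans (*-zeroʳ (m choose 1)) (sym (*-zeroʳ (suc m choose 1))))
shapeCount-suc m (suc k) true  true  = begin
  b * bothValues (suc (suc k)) + ((a * g + a) + (a * g + a))   ≡⟨ cong (λ e → b * e + ((a * g + a) + (a * g + a))) (bothValues-suc k) ⟩
  b * (2 * (g + 1)) + ((a * g + a) + (a * g + a))              ≡⟨ regroup a b g ⟩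
  (a + b) * (2 * (g + 1))                                      ≡⟨ cong₂ _*_ (choose-pascal m (suc k)) (sym (bothValues-suc k)) ⟩
  suc m choose suc (suc k) * bothValues (suc (suc k))          ∎
  where
  open ≡-Reasoning
  a = m choose suc k
  b = m choose suc (suc k)
  g = bothValues (suc k)
  regroup : ∀ a b g → b * (2 * (g + 1)) + ((a * g + a) + (a * g + a)) ≡ (a + b) * (2 * (g + 1))
  regroup = solve-∀

length-layersWith : ∀ {n} (R : Vec Bool n) k p q → length (layersWith R k p q) ≡ shapeCount (card R) k p q
length-layersWith []          zero    false false = refl
length-layersWith []          zero    false true  = refl
length-layersWith []          zero    true  _     = refl
length-layersWith []          (suc k) false false = refl
length-layersWith []          (suc k) true  false = sym (empty-choose k)
length-layersWith []          (suc k) false true  = sym (empty-choose k)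
length-layersWith []          (suc k) true  true  = sym (cong (_* bothValues (suc k)) (empty-choose k))
length-layersWith (false ∷ R) k       p     q     = trans (length-map (nothing ∷_) (layersWith R k p q)) (length-layersWith R k p q)
length-layersWith (true ∷ R)  zero    p     q     =
  trans (length-map (nothing ∷_) (layersWith R zero p q)) (trans (length-layersWith R zero p q) (shapeCount-zero _ _ p q))
length-layersWith (true ∷ R)  (suc k) p     q     = begin
  length (List.map (nothing ∷_) (layersWith R (suc k) p q) ++ List.map (just true ∷_) Bs ++ List.map (just false ∷_) Cs)
    ≡⟨ length-++ (List.map (nothing ∷_) (layersWith R (suc k) p q)) ⟩
  length (List.map (nothing ∷_) (layersWith R (suc k) p q)) + length (List.map (just true ∷_) Bs ++ List.map (just false ∷_) Cs)
    ≡⟨ cong₂ _+_ (length-map (nothing ∷_) (layersWith R (suc k) p q))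
                 (trans (length-++ (List.map (just true ∷_) Bs)) (cong₂ _+_ (length-map (just true ∷_) Bs) (length-map (just false ∷_) Cs))) ⟩
  length (layersWith R (suc k) p q) + (length Bs + length Cs)
    ≡⟨ cong₂ _+_ (length-layersWith R (suc k) p q)
                 (cong₂ _+_ (trans (length-when p _) (cong (count-if p) (trans (length-++ (layersWith R k true q))
                                    (cong₂ _+_ (length-layersWith R k true q) (length-layersWith R k false q)))))
                            (trans (length-when q _) (cong (count-if q) (trans (length-++ (layersWith R k p true))
                                    (cong₂ _+_ (length-layersWith R k p true) (length-layersWith R k p false)))))) ⟩
  shapeCount (card R) (suc k) p q + (count-if p (shapeCount (card R) k true q + shapeCount (card R) k false q) +
                                     count-if q (shapeCount (card R) k p true + shapeCount (card R) k p false))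
    ≡⟨ shapeCount-suc (card R) k p q ⟩
  shapeCount (suc (card R)) (suc k) p q ∎
  where
  open ≡-Reasoning
  Bs = when p (layersWith R k true q ++ layersWith R k false q)
  Cs = when q (layersWith R k p true ++ layersWith R k p false)

valueCount : ∀ {n} → Layer n → ℕ
valueCount L = length (layerLabels L)

classes-∷ : ∀ {n} (L : Layer n) Ls → classes (L ∷ Ls) ≡ valueCount L + classes Ls
classes-∷ L Ls = trans (length-++ (layerLabels L)) (cong (valueCount L +_) (length-map shift (labels Ls)))

-- The number of ways to give k variables canalising values with exactly t distinct values.
valueFactor : ℕ → ℕ → ℕ
valueFactor 1 k = 2
valueFactor 2 k = bothValues k
valueFactor _ k = 0

layersOf : ∀ {n} → Vec Bool n → ℕ → ℕ → List (Layer n)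
layersOf R k 1 = layersWith R k true false ++ layersWith R k false true
layersOf R k 2 = layersWith R k true true
layersOf R k _ = []

valueCount-shape : ∀ {n} {R : Vec Bool n} {k p q L} → Shape R k p q L →
  valueCount L ≡ length ([ 0 , true ]if p ++ [ 0 , false ]if q)
valueCount-shape (shape _ _ refl refl) = refl

layersOf-∈ : ∀ {n} (R : Vec Bool n) k t {L} → L ∈ layersOf R k t → L ⊆ R × size L ≡ k × valueCount L ≡ t
layersOf-∈ R k 1 L∈ with ∈-++⁻ (layersWith R k true false) L∈
... | inj₁ L∈TF = let S = layersWith-shape R k true false L∈TF in Shape.within S , Shape.size≡ S , valueCount-shape S
... | inj₂ L∈FT = let S = layersWith-shape R k false true L∈FT in Shape.within S , Shape.size≡ S , valueCount-shape S
layersOf-∈ R k 2 L∈ = let S = layersWith-shape R k true true L∈ in Shape.within S , Shape.size≡ S , valueCount-shape S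

layersOf-complete : ∀ {n} (R : Vec Bool n) L → L ⊆ R → 1 ≤ size L → L ∈ layersOf R (size L) (valueCount L)
layersOf-complete R L sub nonempty = place (hasValue L true) (hasValue L false) refl refl (layersWith-complete R L sub)
  where
  place : ∀ p q → hasValue L true ≡ p → hasValue L false ≡ q → L ∈ layersWith R (size L) p q →
          L ∈ layersOf R (size L) (length ([ 0 , true ]if p ++ [ 0 , false ]if q))
  place true  false _ _ L∈ = ∈-++⁺ˡ L∈
  place false true  _ _ L∈ = ∈-++⁺ʳ (layersWith R (size L) true false) L∈
  place true  true  _ _ L∈ = L∈
  place false false no-true no-false _ with some-variable L nonempty
  ... | k , true  , Lk with () ← trans (sym no-true) (fires-intro L _ k true Lk refl)
  ... | k , false , Lk with () ← trans (sym no-false) (fires-intro L _ k false Lk refl)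

length-layersOf : ∀ {n} (R : Vec Bool n) k t → 1 ≤ k → length (layersOf R k t) ≡ card R choose k * valueFactor t k
length-layersOf R k       0                   _ = sym (*-zeroʳ (card R choose k))
length-layersOf R (suc k) 1                   _ =
  trans (length-++ (layersWith R (suc k) true false))
        (trans (cong₂ _+_ (length-layersWith R (suc k) true false) (length-layersWith R (suc k) false true))
               (twice (card R choose suc k)))
  where
  twice : ∀ a → a + a ≡ a * 2
  twice = solve-∀
length-layersOf R (suc k) 2                   _ = length-layersWith R (suc k) true true
length-layersOf R k       (suc (suc (suc t))) _ = sym (*-zeroʳ (card R choose k))

layersOf-unique : ∀ {n} (R : Vec Bool n) k t → Unique (layersOf R k t)
layersOf-unique R k 0 = []
layersOf-unique R k 1 = Unique.++⁺ (layersWith-unique R k true false) (layersWith-unique R k false true) apart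
  where
  apart : ∀ {L} → ¬ (L ∈ layersWith R k true false × L ∈ layersWith R k false true)
  apart (L∈TF , L∈FT) with () ← trans (sym (Shape.true∈ (layersWith-shape R k true false L∈TF)))
                                      (Shape.true∈ (layersWith-shape R k false true L∈FT))
layersOf-unique R k 2 = layersWith-unique R k true true
layersOf-unique R k (suc (suc (suc t))) = []

∈-concatMap⁺′ : ∀ {A B : Set} (g : A → List B) {x y xs} → x ∈ xs → y ∈ g x → y ∈ List.concatMap g xs
∈-concatMap⁺′ g x∈ y∈ = ∈-concatMap⁺ g (lose x∈ y∈)

∈-concatMap⁻′ : ∀ {A B : Set} (g : A → List B) {y} xs → y ∈ List.concatMap g xs → ∃ λ x → x ∈ xs × y ∈ g x
∈-concatMap⁻′ g xs y∈ = find (∈-concatMap⁻ g {xs = xs} y∈)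

unique-concatMap : ∀ {A B : Set} (g : A → List B) {xs} → Unique xs → (∀ x → Unique (g x)) →
  (∀ {x y u} → u ∈ g x → u ∈ g y → x ≡ y) → Unique (List.concatMap g xs)
unique-concatMap g {xs} unique-xs unique-g determines =
  Unique.concat⁺ (Allₚ.map⁺ (All.tabulate (λ {x} _ → unique-g x)))
                 (AllPairsₚ.map⁺ (AllPairs.map (λ x≢y {_} (u∈ , u∈′) → x≢y (determines u∈ u∈′)) unique-xs))

layerings : ∀ {n r} → Vec Bool n → Vec ℕ r → Vec ℕ r → List (List (Layer n))
layerings R []       []       = [] ∷ []
layerings R (k ∷ ks) (t ∷ ts) = List.concatMap (λ L → List.map (L ∷_) (layerings (R ∖ L) ks ts)) (layersOf R k t)

∈-layerings⁻ : ∀ {n r} (R : Vec Bool n) k t (ks ts : Vec ℕ r) {Ls} → Ls ∈ layerings R (k ∷ ks) (t ∷ ts) →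
  ∃₂ λ L Ls′ → Ls ≡ L ∷ Ls′ × L ∈ layersOf R k t × Ls′ ∈ layerings (R ∖ L) ks ts
∈-layerings⁻ R k t ks ts Ls∈
  with L , L∈ , Ls∈′ ← ∈-concatMap⁻′ (λ L → List.map (L ∷_) (layerings (R ∖ L) ks ts)) (layersOf R k t) Ls∈
                              with Ls′ , Ls′∈ , refl ← ∈-map⁻ (L ∷_) Ls∈′ = L , Ls′ , refl , L∈ , Ls′∈

length-∈-layerings : ∀ {n r} (R : Vec Bool n) (ks ts : Vec ℕ r) {Ls} → Ls ∈ layerings R ks ts → length Ls ≡ r
length-∈-layerings R []       []       (here refl) = refl
length-∈-layerings R (k ∷ ks) (t ∷ ts) Ls∈ with L , Ls′ , refl , _ , Ls′∈ ← ∈-layerings⁻ R k t ks ts Ls∈ =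
  cong suc (length-∈-layerings (R ∖ L) ks ts Ls′∈)

last≥2-tail : ∀ {r} k (ks : Vec ℕ r) → lastB (2 ≤ᵇ_) (k ∷ ks) ≡ true → lastB (2 ≤ᵇ_) ks ≡ true
last≥2-tail k []       _    = refl
last≥2-tail k (_ ∷ ks) last = last

sum-tail : ∀ {n r} (R : Vec Bool n) L (ks : Vec ℕ r) → L ⊆ R → vsum (size L ∷ ks) ≡ card R → vsum ks ≡ card (R ∖ L)
sum-tail R L ks sub sum =
  +-cancelˡ-≡ (size L) (vsum ks) _ (trans sum (trans (sym (card-∖ R L sub)) (+-comm (card (R ∖ L)) (size L))))

last-layer-size : ∀ {n r} (R : Vec Bool n) k (ks ts : Vec ℕ r) {Ls} → Ls ∈ layerings R ks ts →
  lastB (2 ≤ᵇ_) (k ∷ ks) ≡ true → Ls ≡ [] → 2 ≤ k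
last-layer-size R k []        []        _   last _ = ≤ᵇ⇒≤ 2 k (≡true⇒T last)
last-layer-size R k (k′ ∷ ks) (t′ ∷ ts) Ls∈ _ refl with _ , _ , () , _ ← ∈-layerings⁻ R k′ t′ ks ts Ls∈

layerings-layering : ∀ {n r} (R : Vec Bool n) (ks ts : Vec ℕ r) {Ls} → Ls ∈ layerings R ks ts →
  vsum ks ≡ card R → allB (1 ≤ᵇ_) ks ≡ true → lastB (2 ≤ᵇ_) ks ≡ true →
  Layering R Ls × classes Ls ≡ vsum ts
layerings-layering R [] [] (here refl) sum _ _ = done (card-zero R (sym sum)) , refl
layerings-layering R (k ∷ ks) (t ∷ ts) Ls∈ sum positive last
  with L , Ls′ , refl , L∈ , Ls′∈ ← ∈-layerings⁻ R k t ks ts Ls∈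
  with sub , refl , refl ← layersOf-∈ R k t L∈
  with V , classes≡ ← layerings-layering (R ∖ L) ks ts Ls′∈ (sum-tail R L ks sub sum) (proj₂ (∧-true⁻ positive))
                                          (last≥2-tail (size L) ks last) =
  next sub (≤ᵇ⇒≤ 1 (size L) (≡true⇒T (proj₁ (∧-true⁻ positive)))) last-layer V ,
  trans (classes-∷ L Ls′) (cong (valueCount L +_) classes≡)
  where
  last-layer : Ls′ ≡ [] → 2 ≤ size L
  last-layer = last-layer-size (R ∖ L) (size L) ks ts Ls′∈ last

valueCounts : ∀ {n} (Ls : List (Layer n)) → Vec ℕ (length Ls)
valueCounts []       = []
valueCounts (L ∷ Ls) = valueCount L ∷ valueCounts Ls

layerings-complete : ∀ {n} {R : Vec Bool n} {Ls} → Layering R Ls → Ls ∈ layerings R (sizes Ls) (valueCounts Ls)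
layerings-complete (done _) = here refl
layerings-complete {R = R} (next {L = L} {Ls} sub nonempty _ tail) =
  ∈-concatMap⁺′ (λ L′ → List.map (L′ ∷_) (layerings (R ∖ L′) (sizes Ls) (valueCounts Ls)))
    (layersOf-complete R L sub nonempty) (∈-map⁺ (L ∷_) (layerings-complete tail))

layerings-unique : ∀ {n r} (R : Vec Bool n) (ks ts : Vec ℕ r) → Unique (layerings R ks ts)
layerings-unique R []       []       = [] ∷ []
layerings-unique R (k ∷ ks) (t ∷ ts) =
  unique-concatMap _ (layersOf-unique R k t) (λ L → Unique.map⁺ List.∷-injectiveʳ (layerings-unique (R ∖ L) ks ts)) first-layer
  where
  first-layer : ∀ {L L′ Ls} → Ls ∈ List.map (L ∷_) (layerings (R ∖ L) ks ts) →
                Ls ∈ List.map (L′ ∷_) (layerings (R ∖ L′) ks ts) → L ≡ L′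
  first-layer Ls∈ Ls∈′ with _ , _ , refl ← ∈-map⁻ _ Ls∈ | _ , _ , e ← ∈-map⁻ _ Ls∈′ = List.∷-injectiveˡ e

layerings-determined : ∀ {n r} (R : Vec Bool n) (ks ts ks′ ts′ : Vec ℕ r) {Ls} →
  Ls ∈ layerings R ks ts → Ls ∈ layerings R ks′ ts′ → ks ≡ ks′ × ts ≡ ts′
layerings-determined R [] [] [] [] _ _ = refl , refl
layerings-determined R (k ∷ ks) (t ∷ ts) (k′ ∷ ks′) (t′ ∷ ts′) Ls∈ Ls∈′
  with L , Ls₁ , refl , L∈ , Ls₁∈ ← ∈-layerings⁻ R k t ks ts Ls∈
     | L′ , Ls₂ , e , L∈′ , Ls₂∈ ← ∈-layerings⁻ R k′ t′ ks′ ts′ Ls∈′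
  with refl , refl ← List.∷-injective e
  with _ , refl , refl ← layersOf-∈ R k t L∈ | _ , refl , refl ← layersOf-∈ R k′ t′ L∈′
  with refl , refl ← layerings-determined (R ∖ L) ks ts ks′ ts′ Ls₁∈ Ls₂∈ = refl , refl

length-concatMap-const : ∀ {A B : Set} (g : A → List B) xs c → (∀ {x} → x ∈ xs → length (g x) ≡ c) →
  length (List.concatMap g xs) ≡ length xs * c
length-concatMap-const g []       c _     = refl
length-concatMap-const g (x ∷ xs) c const =
  trans (length-++ (g x)) (cong₂ _+_ (const (here refl)) (length-concatMap-const g xs c (const ∘ there)))

layerCounts : ∀ {r} → ℕ → Vec ℕ r → Vec ℕ r → ℕ
layerCounts m []       []       = 1
layerCounts m (k ∷ ks) (t ∷ ts) = (m choose k * valueFactor t k) * layerCounts (m ∸ k) ks ts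

length-layerings : ∀ {n r} (R : Vec Bool n) (ks ts : Vec ℕ r) → allB (1 ≤ᵇ_) ks ≡ true →
  length (layerings R ks ts) ≡ layerCounts (card R) ks ts
length-layerings R []       []       _        = refl
length-layerings R (k ∷ ks) (t ∷ ts) positive =
  trans (length-concatMap-const _ (layersOf R k t) (layerCounts (card R ∸ k) ks ts) rest)
        (cong (_* layerCounts (card R ∸ k) ks ts) (length-layersOf R k t (≤ᵇ⇒≤ 1 k (≡true⇒T (proj₁ (∧-true⁻ positive))))))
  where
  rest : ∀ {L} → L ∈ layersOf R k t → length (List.map (L ∷_) (layerings (R ∖ L) ks ts)) ≡ layerCounts (card R ∸ k) ks ts
  rest {L} L∈ with sub , refl , _ ← layersOf-∈ R k t L∈ =
    trans (length-map (L ∷_) (layerings (R ∖ L) ks ts))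
      (trans (length-layerings (R ∖ L) ks ts (proj₂ (∧-true⁻ positive)))
        (cong (λ m → layerCounts m ks ts) (trans (sym (m+n∸n≡m (card (R ∖ L)) (size L))) (cong (_∸ size L) (card-∖ R L sub)))))

chooseProduct : ∀ {r} → ℕ → Vec ℕ r → ℕ
chooseProduct m []       = 1
chooseProduct m (k ∷ ks) = m choose k * chooseProduct (m ∸ k) ks

valueProduct : ∀ {r} → Vec ℕ r → Vec ℕ r → ℕ
valueProduct []       []       = 1
valueProduct (t ∷ ts) (k ∷ ks) = valueFactor t k * valueProduct ts ks

layerCounts-split : ∀ {r} m (ks ts : Vec ℕ r) → layerCounts m ks ts ≡ chooseProduct m ks * valueProduct ts ks
layerCounts-split m []       []       = refl
layerCounts-split m (k ∷ ks) (t ∷ ts) =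
  trans (cong (m choose k * valueFactor t k *_) (layerCounts-split (m ∸ k) ks ts))
        (interchange (m choose k) (valueFactor t k) (chooseProduct (m ∸ k) ks) (valueProduct ts ks))
  where
  interchange : ∀ a b c d → (a * b) * (c * d) ≡ (a * c) * (b * d)
  interchange = solve-∀

chooseProduct-factorials : ∀ {r} m (ks : Vec ℕ r) → vsum ks ≡ m → chooseProduct m ks * factProd ks ≡ m !
chooseProduct-factorials m []       refl = refl
chooseProduct-factorials m (k ∷ ks) sum = begin
  (m choose k * chooseProduct (m ∸ k) ks) * (k ! * factProd ks) ≡⟨ regroup (m choose k) (chooseProduct (m ∸ k) ks) (k !) (factProd ks) ⟩
  (m choose k * k !) * (chooseProduct (m ∸ k) ks * factProd ks) ≡⟨ cong ((m choose k * k !) *_) (chooseProduct-factorials (m ∸ k) ks sum′) ⟩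
  (m choose k * k !) * (m ∸ k) !                                 ≡⟨ *-assoc (m choose k) (k !) ((m ∸ k) !) ⟩
  m choose k * (k ! * (m ∸ k) !)                                 ≡⟨ choose-factorial m k k≤m ⟩
  m !                                                            ∎
  where
  open ≡-Reasoning
  regroup : ∀ a b c d → (a * b) * (c * d) ≡ (a * c) * (b * d)
  regroup = solve-∀
  k≤m : k ≤ m
  k≤m = subst (k ≤_) sum (m≤m+n k (vsum ks))
  sum′ : vsum ks ≡ m ∸ k
  sum′ = trans (sym (m+n∸m≡n k (vsum ks))) (cong (_∸ k) sum)

multinomial≡chooseProduct : ∀ {r} m (ks : Vec ℕ r) → vsum ks ≡ m → multinomial m ks ≡ chooseProduct m ks
multinomial≡chooseProduct m ks sum =
  trans (/-congˡ {{factProd≢0 ks}} (sym (chooseProduct-factorials m ks sum)))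
        (m*n/n≡m (chooseProduct m ks) (factProd ks) {{factProd≢0 ks}})

size-positive : ∀ {n} (L : Layer n) k c → lookup L k ≡ just c → 1 ≤ size L
size-positive (just _ ∷ L)  zero    c e = s≤s z≤n
size-positive (nothing ∷ L) (suc k) c e = size-positive L k c e
size-positive (just _ ∷ L)  (suc k) c e = s≤s z≤n

size-two : ∀ {n} (L : Layer n) k₁ k₂ c₁ c₂ → lookup L k₁ ≡ just c₁ → lookup L k₂ ≡ just c₂ → ¬ k₁ ≡ k₂ → 2 ≤ size L
size-two (_ ∷ L)       zero     zero     c₁ c₂ e₁ e₂ k₁≢k₂ = ⊥-elim (k₁≢k₂ refl)
size-two (just _ ∷ L)  zero     (suc k₂) c₁ c₂ e₁ e₂ _     = s≤s (size-positive L k₂ c₂ e₂)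
size-two (just _ ∷ L)  (suc k₁) zero     c₁ c₂ e₁ e₂ _     = s≤s (size-positive L k₁ c₁ e₁)
size-two (nothing ∷ L) (suc k₁) (suc k₂) c₁ c₂ e₁ e₂ k₁≢k₂ = size-two L k₁ k₂ c₁ c₂ e₁ e₂ (k₁≢k₂ ∘ cong suc)
size-two (just _ ∷ L)  (suc k₁) (suc k₂) c₁ c₂ e₁ e₂ k₁≢k₂ =
  ≤-trans (size-two L k₁ k₂ c₁ c₂ e₁ e₂ (k₁≢k₂ ∘ cong suc)) (n≤1+n _)

size≤ : ∀ {n} (L : Layer n) → size L ≤ n
size≤ []            = z≤n
size≤ (nothing ∷ L) = m≤n⇒m≤1+n (size≤ L)
size≤ (just _ ∷ L)  = s≤s (size≤ L)

valueCount-bounds : ∀ {n} (L : Layer n) → 1 ≤ size L → 1 ≤ valueCount L × valueCount L ≤ 2 × valueCount L ≤ size L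
valueCount-bounds L nonempty with hasValue L true in has-true | hasValue L false in has-false
... | true  | false = s≤s z≤n , s≤s z≤n , nonempty
... | false | true  = s≤s z≤n , s≤s z≤n , nonempty
... | true  | true  with k₁ , Lk₁ ← fires-elim L _ has-true | k₂ , Lk₂ ← fires-elim L _ has-false =
  s≤s z≤n , ≤-refl , size-two L k₁ k₂ true false Lk₁ Lk₂ λ { refl → case trans (sym Lk₁) Lk₂ of λ () }
... | false | false with some-variable L nonempty
...   | k , true  , Lk with () ← trans (sym has-true) (fires-intro L _ k true Lk refl)
...   | k , false , Lk with () ← trans (sym has-false) (fires-intro L _ k false Lk refl)

≡⇒≡ᵇ≡true : ∀ {m n} → m ≡ n → (m ≡ᵇ n) ≡ true
≡⇒≡ᵇ≡true {m} {n} m≡n = T⇒≡true (≡⇒≡ᵇ m n m≡n)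

≤⇒≤ᵇ≡true : ∀ {m n} → m ≤ n → (m ≤ᵇ n) ≡ true
≤⇒≤ᵇ≡true m≤n = T⇒≡true (≤⇒≤ᵇ m≤n)

sizes-positive : ∀ {n} {R : Vec Bool n} {Ls} → Layering R Ls → allB (1 ≤ᵇ_) (sizes Ls) ≡ true
sizes-positive (done _) = refl
sizes-positive (next _ nonempty _ tail) rewrite ≤⇒≤ᵇ≡true nonempty = sizes-positive tail

sizes-last : ∀ {n} {R : Vec Bool n} {Ls} → Layering R Ls → lastB (2 ≤ᵇ_) (sizes Ls) ≡ true
sizes-last (done _)                   = refl
sizes-last (next {Ls = []} _ _ last _) = ≤⇒≤ᵇ≡true (last refl)
sizes-last (next {Ls = _ ∷ _} _ _ _ tail) = sizes-last tail

sizes-bounded : ∀ {n} (Ls : List (Layer n)) → VecAll.All (_≤ n) (sizes Ls)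
sizes-bounded []       = []
sizes-bounded (L ∷ Ls) = size≤ L ∷ sizes-bounded Ls

sum-valueCounts : ∀ {n} (Ls : List (Layer n)) → vsum (valueCounts Ls) ≡ classes Ls
sum-valueCounts []       = refl
sum-valueCounts (L ∷ Ls) = trans (cong (valueCount L +_) (sum-valueCounts Ls)) (sym (classes-∷ L Ls))

valueCounts-positive : ∀ {n} {R : Vec Bool n} {Ls} → Layering R Ls → allB (1 ≤ᵇ_) (valueCounts Ls) ≡ true
valueCounts-positive (done _) = refl
valueCounts-positive (next {L = L} _ nonempty _ tail)
  rewrite ≤⇒≤ᵇ≡true (proj₁ (valueCount-bounds L nonempty)) = valueCounts-positive tail

valueCounts-bounded : ∀ {n} {R : Vec Bool n} {Ls} → Layering R Ls →
  allB₂ (λ t k → t ≤ᵇ 2 ⊓ k) (valueCounts Ls) (sizes Ls) ≡ true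
valueCounts-bounded (done _) = refl
valueCounts-bounded (next {L = L} _ nonempty _ tail)
  with _ , ≤2 , ≤size ← valueCount-bounds L nonempty rewrite ≤⇒≤ᵇ≡true (⊓-glb ≤2 ≤size) = valueCounts-bounded tail

valueCounts-≤2 : ∀ {n} {R : Vec Bool n} {Ls} → Layering R Ls → VecAll.All (_≤ 2) (valueCounts Ls)
valueCounts-≤2 (done _) = []
valueCounts-≤2 (next {L = L} _ nonempty _ tail) = proj₁ (proj₂ (valueCount-bounds L nonempty)) ∷ valueCounts-≤2 tail

layers≤classes : ∀ {n} {R : Vec Bool n} {Ls} → Layering R Ls → length Ls ≤ classes Ls
layers≤classes (done _) = z≤n
layers≤classes (next {L = L} {Ls} _ nonempty _ tail) =
  subst (suc (length Ls) ≤_) (sym (classes-∷ L Ls)) (+-mono-≤ (proj₁ (valueCount-bounds L nonempty)) (layers≤classes tail))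

classes≤2*layers : ∀ {n} {R : Vec Bool n} {Ls} → Layering R Ls → classes Ls ≤ 2 * length Ls
classes≤2*layers (done _) = z≤n
classes≤2*layers (next {L = L} {Ls} _ nonempty _ tail) =
  subst₂ _≤_ (sym (classes-∷ L Ls)) (sym (*-distribˡ-+ 2 1 (length Ls)))
    (+-mono-≤ (proj₁ (proj₂ (valueCount-bounds L nonempty))) (classes≤2*layers tail))

-- The counting formula

-- Opened only now: +_ makes sections of ℕ's _+_ such as (a +_) ambiguous.
open ℤ using (+_)

∈-tuples : ∀ {r} bound (v : Vec ℕ r) → VecAll.All (_≤ bound) v → v ∈ tuples r bound
∈-tuples bound []      []         = here refl
∈-tuples bound (x ∷ v) (x≤ ∷ v≤) =
  ∈-concatMap⁺′ (λ w → List.map (_∷ w) (upTo (suc bound))) (∈-tuples bound v v≤) (∈-map⁺ (_∷ v) (∈-upTo⁺ (s≤s x≤)))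

tuples-unique : ∀ r bound → Unique (tuples r bound)
tuples-unique zero    bound = [] ∷ []
tuples-unique (suc r) bound =
  unique-concatMap _ (tuples-unique r bound) (λ _ → Unique.map⁺ ∷-injectiveˡ (Unique.upTo⁺ (suc bound))) same-tail
  where
  same-tail : ∀ {v w u} → u ∈ List.map (_∷ v) (upTo (suc bound)) → u ∈ List.map (_∷ w) (upTo (suc bound)) → v ≡ w
  same-tail u∈ u∈′ with _ , _ , refl ← ∈-map⁻ _ u∈ | _ , _ , e ← ∈-map⁻ _ u∈′ = ∷-injectiveʳ e

size-conditions? : ∀ {r} n → Vec ℕ r → Bool
size-conditions? n k = (vsum k ≡ᵇ n) ∧ allB (1 ≤ᵇ_) k ∧ lastB (2 ≤ᵇ_) k

value-conditions? : ∀ {r} s → Vec ℕ r → Vec ℕ r → Bool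
value-conditions? s k t = (vsum t ≡ᵇ s) ∧ allB (1 ≤ᵇ_) t ∧ allB₂ (λ tᵢ kᵢ → tᵢ ≤ᵇ 2 ⊓ kᵢ) t k

∈-ks⁻ : ∀ {r} n (k : Vec ℕ r) → k ∈ ks r n → vsum k ≡ n × allB (1 ≤ᵇ_) k ≡ true × lastB (2 ≤ᵇ_) k ≡ true
∈-ks⁻ {r} n k k∈ with _ , conditions ← ∈-filter⁻ (λ k → T? (size-conditions? n k)) {xs = tuples r n} k∈
  with sum , rest ← ∧-true⁻ (T⇒≡true conditions) with positive , last ← ∧-true⁻ rest =
  ≡ᵇ⇒≡ (vsum k) n (≡true⇒T sum) , positive , last

valueFactor≡factor : ∀ t k → 1 ≤ t → t ≤ 2 → t ≤ k → factor t k ≡ + valueFactor t k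
valueFactor≡factor 1 k _ _ _ = refl
valueFactor≡factor 2 zero _ _ ()
valueFactor≡factor 2 (suc k) _ _ _ = begin
  ℤ.1ℤ ℤ.* X ℤ.+ ℤ.1ℤ ℤ.- ℤ.1ℤ  ≡⟨ cong (λ y → y ℤ.+ ℤ.1ℤ ℤ.- ℤ.1ℤ) (ℤP.*-identityˡ X) ⟩
  X ℤ.+ ℤ.1ℤ ℤ.- ℤ.1ℤ           ≡⟨ ℤP.+-assoc X ℤ.1ℤ ℤ.-1ℤ ⟩
  X ℤ.+ ℤ.0ℤ                    ≡⟨ ℤP.+-identityʳ X ⟩
  X                             ≡⟨ ℤP.m-n≡m⊖n (2 ^ suc k) 2 ⟩
  2 ^ suc k ℤ.⊖ 2               ≡⟨ ℤP.⊖-≥ (2≤2^suc k) ⟩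
  + bothValues (suc k)        ∎
  where
  open ≡-Reasoning
  X = + (2 ^ suc k) ℤ.- + 2
valueFactor≡factor (suc (suc (suc t))) k _ (s≤s (s≤s ())) _

valueProduct≡vprodZ : ∀ {r} (ts ks : Vec ℕ r) → T (allB (1 ≤ᵇ_) ts) → T (allB₂ (λ tᵢ kᵢ → tᵢ ≤ᵇ 2 ⊓ kᵢ) ts ks) →
  vprodZ ts ks ≡ + valueProduct ts ks
valueProduct≡vprodZ []       []       _ _ = refl
valueProduct≡vprodZ (t ∷ ts) (k ∷ ks) positive bounded
  with 1≤t , positive′ ← Equivalence.to T-∧ positive | t≤ , bounded′ ← Equivalence.to T-∧ bounded =
  trans (cong₂ ℤ._*_ (valueFactor≡factor t k (≤ᵇ⇒≤ 1 t 1≤t) (≤-trans t≤2⊓k (m⊓n≤m 2 k)) (≤-trans t≤2⊓k (m⊓n≤n 2 k)))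
                      (valueProduct≡vprodZ ts ks positive′ bounded′))
        (sym (ℤP.pos-* (valueFactor t k) (valueProduct ts ks)))
  where
  t≤2⊓k = ≤ᵇ⇒≤ t (2 ⊓ k) t≤

∈-ts⁻ : ∀ {r} s (k t : Vec ℕ r) → t ∈ ts s k → vsum t ≡ s × vprodZ t k ≡ + valueProduct t k
∈-ts⁻ {r} s k t t∈ with _ , conditions ← ∈-filter⁻ (λ t → T? (value-conditions? s k t)) {xs = tuples r s} t∈
  with sum , rest ← Equivalence.to T-∧ conditions with positive , bounded ← Equivalence.to T-∧ rest =
  ≡ᵇ⇒≡ (vsum t) s sum , valueProduct≡vprodZ t k positive bounded

⌈/2⌉≤ : ∀ s r → s ≤ 2 * r → ⌈ s /2⌉ ≤ r
⌈/2⌉≤ zero          r       _ = z≤n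
⌈/2⌉≤ (suc zero)    (suc r) _ = s≤s z≤n
⌈/2⌉≤ (suc (suc s)) (suc r) h = s≤s (⌈/2⌉≤ s r (≤-pred (≤-pred (subst (suc (suc s) ≤_) (+-suc (suc r) (r + 0)) h))))

layeringsOfType : ∀ n s r → List (List (Layer n))
layeringsOfType n s r = List.concatMap (λ k → List.concatMap (λ t → layerings (full n) k t) (ts s k)) (ks r n)

layeringsWithClasses : ∀ n s → List (List (Layer n))
layeringsWithClasses n s = List.concatMap (layeringsOfType n s) (rs s)

∈-layeringsOfType⁻ : ∀ n s r {Ls} → Ls ∈ layeringsOfType n s r →
  ∃₂ λ k t → k ∈ ks r n × t ∈ ts s k × Ls ∈ layerings (full n) k t
∈-layeringsOfType⁻ n s r Ls∈
  with k , k∈ , Ls∈′ ← ∈-concatMap⁻′ (λ k → List.concatMap (λ t → layerings (full n) k t) (ts s k)) (ks r n) Ls∈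
  with t , t∈ , Ls∈″ ← ∈-concatMap⁻′ (λ t → layerings (full n) k t) (ts s k) Ls∈′ = k , t , k∈ , t∈ , Ls∈″

∈-layeringsWithClasses⁻ : ∀ n s {Ls} → Ls ∈ layeringsWithClasses n s → Layering (full n) Ls × classes Ls ≡ s
∈-layeringsWithClasses⁻ n s Ls∈
  with r , _ , Ls∈′ ← ∈-concatMap⁻′ (layeringsOfType n s) (rs s) Ls∈
  with k , t , k∈ , t∈ , Ls∈″ ← ∈-layeringsOfType⁻ n s r Ls∈′
  with sum , positive , last ← ∈-ks⁻ n k k∈
  with V , classes≡ ← layerings-layering (full n) k t Ls∈″ (trans sum (sym (card-full n))) positive last =
  V , trans classes≡ (proj₁ (∈-ts⁻ s k t t∈))

∈-layeringsWithClasses⁺ : ∀ n s {Ls} → 2 ≤ s → Layering (full n) Ls → classes Ls ≡ s → Ls ∈ layeringsWithClasses n s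
∈-layeringsWithClasses⁺ n s {Ls} 2≤s V classes≡s =
  ∈-concatMap⁺′ (layeringsOfType n s) r∈
    (∈-concatMap⁺′ (λ k → List.concatMap (λ t → layerings (full n) k t) (ts s k)) k∈
      (∈-concatMap⁺′ (λ t → layerings (full n) (sizes Ls) t) t∈ (layerings-complete V)))
  where
  r∈ : length Ls ∈ rs s
  r∈ = ∈-filter⁺ (λ r → ⌈ s /2⌉ ℕ.≤? r) (∈-upTo⁺ (s≤s (subst (length Ls ≤_) classes≡s (layers≤classes V))))
                 (⌈/2⌉≤ s (length Ls) (subst (_≤ 2 * length Ls) classes≡s (classes≤2*layers V)))
  k∈ : sizes Ls ∈ ks (length Ls) n
  k∈ = ∈-filter⁺ (λ k → T? (size-conditions? n k)) (∈-tuples n (sizes Ls) (sizes-bounded Ls))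
         (≡true⇒T (∧-true⁺ (≡⇒≡ᵇ≡true (trans (sum-sizes V) (card-full n))) (∧-true⁺ (sizes-positive V) (sizes-last V))))
  t∈ : valueCounts Ls ∈ ts s (sizes Ls)
  t∈ = ∈-filter⁺ (λ t → T? (value-conditions? s (sizes Ls) t))
         (∈-tuples s (valueCounts Ls) (VecAll.map (λ t≤2 → ≤-trans t≤2 2≤s) (valueCounts-≤2 V)))
         (≡true⇒T (∧-true⁺ (≡⇒≡ᵇ≡true (trans (sum-valueCounts Ls) classes≡s))
                          (∧-true⁺ (valueCounts-positive V) (valueCounts-bounded V))))

layeringsWithClasses-unique : ∀ n s → Unique (layeringsWithClasses n s)
layeringsWithClasses-unique n s =
  unique-concatMap (layeringsOfType n s) (Unique.filter⁺ (λ r → ⌈ s /2⌉ ℕ.≤? r) (Unique.upTo⁺ (suc s))) of-type same-length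
  where
  same-length : ∀ {r r′ Ls} → Ls ∈ layeringsOfType n s r → Ls ∈ layeringsOfType n s r′ → r ≡ r′
  same-length {r} {r′} Ls∈ Ls∈′ with k , t , _ , _ , Ls∈k ← ∈-layeringsOfType⁻ n s r Ls∈
                                  | k′ , t′ , _ , _ , Ls∈k′ ← ∈-layeringsOfType⁻ n s r′ Ls∈′ =
    trans (sym (length-∈-layerings (full n) k t Ls∈k)) (length-∈-layerings (full n) k′ t′ Ls∈k′)
  of-type : ∀ r → Unique (layeringsOfType n s r)
  of-type r = unique-concatMap _ (Unique.filter⁺ (λ k → T? (size-conditions? n k)) (tuples-unique r n))
    (λ k → unique-concatMap _ (Unique.filter⁺ (λ t → T? (value-conditions? s k t)) (tuples-unique r s))
             (λ t → layerings-unique (full n) k t)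
             (λ {t} {t′} Ls∈ Ls∈′ → proj₂ (layerings-determined (full n) k t k t′ Ls∈ Ls∈′)))
    same-sizes
    where
    same-sizes : ∀ {k k′ Ls} → Ls ∈ List.concatMap (λ t → layerings (full n) k t) (ts s k) →
                 Ls ∈ List.concatMap (λ t → layerings (full n) k′ t) (ts s k′) → k ≡ k′
    same-sizes {k} {k′} Ls∈ Ls∈′
      with t , _ , Ls∈t ← ∈-concatMap⁻′ (λ t → layerings (full n) k t) (ts s k) Ls∈
         | t′ , _ , Ls∈t′ ← ∈-concatMap⁻′ (λ t → layerings (full n) k′ t) (ts s k′) Ls∈′ =
      proj₁ (layerings-determined (full n) k t k′ t′ Ls∈t Ls∈t′)

sumZ-cong : ∀ {A : Set} (f g : A → ℤ.ℤ) xs → (∀ {x} → x ∈ xs → f x ≡ g x) → sumZ (List.map f xs) ≡ sumZ (List.map g xs)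
sumZ-cong f g xs f≡g = cong sumZ (List.map-cong-local (All.tabulate f≡g))

sumZ-*ˡ : ∀ {A : Set} c (f : A → ℤ.ℤ) xs → sumZ (List.map (λ x → c ℤ.* f x) xs) ≡ c ℤ.* sumZ (List.map f xs)
sumZ-*ˡ c f []       = sym (ℤP.*-zeroʳ c)
sumZ-*ˡ c f (x ∷ xs) = trans (cong (λ y → c ℤ.* f x ℤ.+ y) (sumZ-*ˡ c f xs)) (sym (ℤP.*-distribˡ-+ c (f x) _))

+length-concatMap : ∀ {A B : Set} (g : A → List B) xs →
  + length (List.concatMap g xs) ≡ sumZ (List.map (λ x → + length (g x)) xs)
+length-concatMap g []       = refl
+length-concatMap g (x ∷ xs) =
  trans (cong +_ (length-++ (g x))) (trans (ℤP.pos-+ (length (g x)) _) (cong (λ y → + length (g x) ℤ.+ y) (+length-concatMap g xs)))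

+length-layeringsWithClasses : ∀ n s → + length (layeringsWithClasses n s) ≡
  sumZ (List.map (λ r → sumZ (List.map (λ k → + multinomial n k ℤ.* sumZ (List.map (λ t → vprodZ t k) (ts s k))) (ks r n))) (rs s))
+length-layeringsWithClasses n s =
  trans (+length-concatMap (layeringsOfType n s) (rs s)) (sumZ-cong _ _ (rs s) λ {r} _ →
  trans (+length-concatMap _ (ks r n)) (sumZ-cong _ _ (ks r n) λ {k} k∈ →
  trans (+length-concatMap _ (ts s k)) (trans (sumZ-cong _ _ (ts s k) (λ {t} t∈ → count k∈ t∈))
        (sumZ-*ˡ (+ multinomial n k) (λ t → vprodZ t k) (ts s k)))))
  where
  count : ∀ {r} {k t : Vec ℕ r} → k ∈ ks r n → t ∈ ts s k →
          + length (layerings (full n) k t) ≡ + multinomial n k ℤ.* vprodZ t k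
  count {k = k} {t} k∈ t∈ with sum , positive , _ ← ∈-ks⁻ n k k∈ = begin
    + length (layerings (full n) k t)                  ≡⟨ cong +_ (length-layerings (full n) k t positive) ⟩
    + layerCounts (card (full n)) k t                  ≡⟨ cong (λ m → + layerCounts m k t) (card-full n) ⟩
    + layerCounts n k t                                ≡⟨ cong +_ (layerCounts-split n k t) ⟩
    + (chooseProduct n k * valueProduct t k)           ≡⟨ cong (λ c → + (c * valueProduct t k)) (sym (multinomial≡chooseProduct n k sum)) ⟩
    + (multinomial n k * valueProduct t k)             ≡⟨ ℤP.pos-* (multinomial n k) (valueProduct t k) ⟩
    + multinomial n k ℤ.* + valueProduct t k           ≡⟨ cong (+ multinomial n k ℤ.*_) (sym (proj₂ (∈-ts⁻ s k t t∈))) ⟩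
    + multinomial n k ℤ.* vprodZ t k                   ∎
    where open ≡-Reasoning

distinct-images : ∀ {A B : Set} (_≈_ : B → B → Set) (f : A → B) {P : A → Set} {xs} → All P xs → Unique xs →
  (∀ {x y} → P x → P y → f x ≈ f y → x ≡ y) → AllPairs (λ u v → ¬ u ≈ v) (List.map f xs)
distinct-images _≈_ f []         []         injective = []
distinct-images _≈_ f (px ∷ pxs) (x∉ ∷ xs!) injective =
  Allₚ.map⁺ (All.tabulate λ y∈ fx≈fy → All.lookup x∉ y∈ (injective px (All.lookup pxs y∈) fx≈fy)) ∷
  distinct-images _≈_ f pxs xs! injective

IsSSymmetric-resp-≐ : ∀ {n} s {f g : BoolFun n} → f ≐ g → IsSSymmetric s f → IsSSymmetric s g
IsSSymmetric-resp-≐ s f≐g (rep , distinct , covering) =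
  rep , (λ p q p≢q g-sym → distinct p q p≢q λ x → trans (f≐g _) (trans (g-sym x) (sym (f≐g x)))) ,
  (λ i → proj₁ (covering i) , λ x → trans (sym (f≐g _)) (trans (proj₂ (covering i) x) (f≐g x)))

representations : ∀ n s → List (Bool × List (Layer n))
representations n s = List.map (true ,_) (layeringsWithClasses n s) ++ List.map (false ,_) (layeringsWithClasses n s)

∈-representations⁻ : ∀ n s {p} → p ∈ representations n s → proj₂ p ∈ layeringsWithClasses n s
∈-representations⁻ n s p∈ with ∈-++⁻ (List.map (true ,_) (layeringsWithClasses n s)) p∈
... | inj₁ p∈T with _ , Ls∈ , refl ← ∈-map⁻ (true ,_) p∈T = Ls∈
... | inj₂ p∈F with _ , Ls∈ , refl ← ∈-map⁻ (false ,_) p∈F = Ls∈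

∈-representations⁺ : ∀ n s b {Ls} → Ls ∈ layeringsWithClasses n s → (b , Ls) ∈ representations n s
∈-representations⁺ n s true  Ls∈ = ∈-++⁺ˡ (∈-map⁺ (true ,_) Ls∈)
∈-representations⁺ n s false Ls∈ = ∈-++⁺ʳ (List.map (true ,_) (layeringsWithClasses n s)) (∈-map⁺ (false ,_) Ls∈)

representations-unique : ∀ n s → Unique (representations n s)
representations-unique n s =
  Unique.++⁺ (Unique.map⁺ ,-injectiveʳ (layeringsWithClasses-unique n s)) (Unique.map⁺ ,-injectiveʳ (layeringsWithClasses-unique n s))
    λ (p∈T , p∈F) → case (∈-map⁻ (true ,_) p∈T , ∈-map⁻ (false ,_) p∈F) of λ { ((_ , _ , refl) , (_ , _ , ())) }

layeredFunctions : ∀ n s → List (BoolFun n)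
layeredFunctions n s = List.map (uncurry layered) (representations n s)

layeredFunctions-ncf : ∀ m s → All (λ f → IsSSymmetric s f × IsNCF f) (layeredFunctions (suc m) s)
layeredFunctions-ncf m s = Allₚ.map⁺ (All.tabulate λ {(b , Ls)} p∈ →
  let V , classes≡s = ∈-layeringsWithClasses⁻ (suc m) s (∈-representations⁻ (suc m) s p∈) in
  subst (λ c → IsSSymmetric c (layered b Ls)) classes≡s (classes-symmetric V (λ k → lookup-replicate k true) b) ,
  layered⇒ncf b Ls V)

layeredFunctions-distinct : ∀ n s → AllPairs (λ f g → ¬ f ≐ g) (layeredFunctions n s)
layeredFunctions-distinct n s =
  distinct-images _≐_ (uncurry layered) (All.tabulate (λ p∈ → proj₁ (∈-layeringsWithClasses⁻ n s (∈-representations⁻ n s p∈))))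
    (representations-unique n s) injective
  where
  injective : ∀ {p q} → Layering (full n) (proj₂ p) → Layering (full n) (proj₂ q) → uncurry layered p ≐ uncurry layered q → p ≡ q
  injective V V′ same with refl , refl ← layered-injective V V′ _ _ same = refl

layeredFunctions-complete : ∀ m s → 2 ≤ s → ∀ (f : BoolFun (suc (suc m))) → IsSSymmetric s f × IsNCF f →
  Any (f ≐_) (layeredFunctions (suc (suc m)) s)
layeredFunctions-complete m s 2≤s f (symmetric , ncf) with b , Ls , V , f≐ ← ncf⇒layered f ncf =
  Any.map (λ {g} layered≡g x → trans (f≐ x) (cong (λ h → h x) layered≡g))
    (∈-map⁺ (uncurry layered) (∈-representations⁺ (suc (suc m)) s b (∈-layeringsWithClasses⁺ (suc (suc m)) s 2≤s V classes≡s)))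
  where
  classes≡s : classes Ls ≡ s
  classes≡s = sym (symmetric⇒classes V (λ k → lookup-replicate k true) b s (IsSSymmetric-resp-≐ s f≐ symmetric))

+length-layeredFunctions : ∀ n s → + length (layeredFunctions n s) ≡ Nformula n s
+length-layeredFunctions n s = begin
  + length (List.map (uncurry layered) (representations n s))  ≡⟨ cong +_ (length-map (uncurry layered) (representations n s)) ⟩
  + length (representations n s)                                 ≡⟨ cong +_ (length-++ (tagged true) {tagged false}) ⟩
  + (length (tagged true) + length (tagged false))               ≡⟨ cong₂ (λ a b → + (a + b)) (length-tagged true) (length-tagged false) ⟩
  + (length W + length W)                                        ≡⟨ cong (λ a → + (length W + a)) (sym (+-identityʳ (length W))) ⟩
  + (2 * length W)                                               ≡⟨ ℤP.pos-* 2 (length W) ⟩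
  + 2 ℤ.* + length W                                             ≡⟨ cong (+ 2 ℤ.*_) (+length-layeringsWithClasses n s) ⟩
  Nformula n s                                                   ∎
  where
  open ≡-Reasoning
  W = layeringsWithClasses n s
  tagged : Bool → List (Bool × List (Layer n))
  tagged b = List.map (b ,_) W
  length-tagged : ∀ b → length (tagged b) ≡ length W
  length-tagged b = length-map {B = Bool × List (Layer n)} (b ,_) W

theorem4p14 : (n s : ℕ) → 3 ≤ n → 2 ≤ s → s ≤ n ∸ 1 →
    ∃Card (λ (f : BoolFun n) → IsSSymmetric s f × IsNCF f) λ N → + N ≡ Nformula n s
theorem4p14 (suc (suc (suc k))) s _ 2≤s _ =
  length (layeredFunctions n s) , +length-layeredFunctions n s ,
  layeredFunctions n s , refl , layeredFunctions-ncf (suc (suc k)) s , layeredFunctions-distinct n s ,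
  layeredFunctions-complete (suc k) s 2≤s
  where n = suc (suc (suc k))
theorem4p14 (suc zero)       s (s≤s ())        _ _
theorem4p14 (suc (suc zero)) s (s≤s (s≤s ())) _ _
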